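{- Let $D$ be a unique factorization domain and let $a, b$ be elements algebraic over $D$ such that $(a+b)^2$ and $ab$ are coprime elements of $D$. Let $A(X,Y), B(X,Y) \in \mathbb{Z}[X,Y]$ be non-constant homogeneous polynomials with resultant $\mathrm{Res}(A,B) = \pm 1$, and assume that $A(a,b)$ and $B(a,b)$ both lie in $D$. Then $A(a,b)$ and $B(a,b)$ are coprime in $D$.
   Context: For homogeneous $A = a_0X^m + \dots + a_mY^m$ and $B = b_0X^n + \dots + b_nY^n$, $\mathrm{Res}(A,B)$ is the determinant of their Sylvester matrix; if $A = a_0\prod_{i}(X-\alpha_iY)$ and $B = b_0\prod_j(X-\beta_jY)$ then $\mathrm{Res}(A,B) = a_0^nb_0^m\prod_{i,j}(\alpha_i-\beta_j)$. Two elements of $D$ are coprime if they have no common prime divisor in $D$. -}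

module Defs where

open import Level using (Level; _⊔_)
open import Algebra.Bundles using (CommutativeRing)
open import Data.Nat as ℕ using (ℕ; zero; suc; _∸_; _<ᵇ_; _≤ᵇ_)
open import Data.Integer as ℤ using (ℤ; +_; -[1+_])
open import Data.Fin as Fin using (Fin; toℕ; punchIn)
open import Data.Vec as Vec using (Vec; []; _∷_; lookup; toList)
open import Data.Vec.Relation.Unary.All as VAll using ()
open import Data.List as List using (List; []; _∷_)
open import Data.List.Relation.Unary.All using (All)
open import Data.List.Relation.Unary.Any using (Any)
open import Data.Bool using (if_then_else_)
open import Data.Product using (Σ; Σ-syntax; _×_)
open import Data.Sum using (_⊎_)
open import Relation.Nullary using (¬_)
open import Relation.Unary using (Pred)
open import Function.Bundles using (_↔_; Inverse)

sumFin : ∀ n → (Fin n → ℤ) → ℤ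
sumFin zero    f = + 0
sumFin (suc n) f = f Fin.zero ℤ.+ sumFin n (λ i → f (Fin.suc i))

sgn : ℕ → ℤ
sgn zero          = + 1
sgn (suc zero)    = ℤ.- (+ 1)
sgn (suc (suc k)) = sgn k

det : ∀ n → (Fin n → Fin n → ℤ) → ℤ
det zero    M = + 1
det (suc n) M =
  sumFin (suc n) λ j →
    sgn (toℕ j) ℤ.* (M Fin.zero j ℤ.* det n (λ i k → M (Fin.suc i) (punchIn j k)))

coefAt : List ℤ → ℕ → ℤ
coefAt []       _       = + 0
coefAt (c ∷ cs) zero    = c
coefAt (c ∷ cs) (suc k) = coefAt cs k

-- A homogeneous polynomial of degree m in ℤ[X,Y],
--   A = a₀ X^m + a₁ X^(m-1) Y + … + a_m Y^m,
-- is represented by its coefficient vector (a₀ , … , a_m).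
HomPoly : ℕ → Set
HomPoly m = Vec ℤ (suc m)

-- Sylvester matrix of A (degree m) and B (degree n): (m+n)×(m+n),
-- rows 0..n-1 are shifted copies of (a₀ … a_m),
-- rows n..n+m-1 are shifted copies of (b₀ … b_n).
sylvester : ∀ m n → HomPoly m → HomPoly n → Fin (m ℕ.+ n) → Fin (m ℕ.+ n) → ℤ
sylvester m n A B r c =
  if toℕ r <ᵇ n
  then (if toℕ r ≤ᵇ toℕ c then coefAt (toList A) (toℕ c ∸ toℕ r) else + 0)
  else (if (toℕ r ∸ n) ≤ᵇ toℕ c then coefAt (toList B) (toℕ c ∸ (toℕ r ∸ n)) else + 0)

Res : ∀ m n → HomPoly m → HomPoly n → ℤ
Res m n A B = det (m ℕ.+ n) (sylvester m n A B)

NonConstant : ∀ {m} → HomPoly m → Set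
NonConstant {m} A = (1 ℕ.≤ m) × Any (λ a → ¬ (a ≡ℤ + 0)) (toList A)
  where open import Relation.Binary.PropositionalEquality using () renaming (_≡_ to _≡ℤ_)

module _ {c ℓ} (K : CommutativeRing c ℓ) where
  open CommutativeRing K

  IsField : Set (c ⊔ ℓ)
  IsField = (1# ≉ 0#) × (∀ x → x ≉ 0# → Σ[ y ∈ Carrier ] (x * y ≈ 1#))

  natK : ℕ → Carrier
  natK zero    = 0#
  natK (suc n) = 1# + natK n

  intK : ℤ → Carrier
  intK (+ n)     = natK n
  intK -[1+ n ]  = - natK (suc n)

  pow : Carrier → ℕ → Carrier
  pow x zero    = 1#
  pow x (suc k) = x * pow x k

  evalHom : ∀ m → HomPoly m → Carrier → Carrier → Carrier
  evalHom zero    (a ∷ [])  x y = intK a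
  evalHom (suc m) (a ∷ as)  x y = intK a * pow x (suc m) + y * evalHom m as x y

  evalPoly : List Carrier → Carrier → Carrier
  evalPoly []       x = 0#
  evalPoly (c ∷ cs) x = c + x * evalPoly cs x

  record IsSubring {ℓ'} (D : Pred Carrier ℓ') : Set (c ⊔ ℓ ⊔ ℓ') where
    field
      resp  : ∀ {x y} → x ≈ y → D x → D y
      has0  : D 0#
      has1  : D 1#
      +-cl  : ∀ {x y} → D x → D y → D (x + y)
      *-cl  : ∀ {x y} → D x → D y → D (x * y)
      neg-cl : ∀ {x} → D x → D (- x)

  module _ {ℓ'} (D : Pred Carrier ℓ') where

    _∣D_ : Carrier → Carrier → Set (c ⊔ ℓ ⊔ ℓ')
    x ∣D y = Σ[ z ∈ Carrier ] (D z × y ≈ x * z)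

    UnitD : Carrier → Set (c ⊔ ℓ ⊔ ℓ')
    UnitD u = D u × Σ[ v ∈ Carrier ] (D v × u * v ≈ 1#)

    AssociatedD : Carrier → Carrier → Set (c ⊔ ℓ ⊔ ℓ')
    AssociatedD x y = Σ[ u ∈ Carrier ] (UnitD u × y ≈ u * x)

    IrreducibleD : Carrier → Set (c ⊔ ℓ ⊔ ℓ')
    IrreducibleD p = D p × p ≉ 0# × ¬ UnitD p ×
      (∀ x y → D x → D y → p ≈ x * y → UnitD x ⊎ UnitD y)

    PrimeD : Carrier → Set (c ⊔ ℓ ⊔ ℓ')
    PrimeD p = D p × p ≉ 0# × ¬ UnitD p ×
      (∀ x y → D x → D y → p ∣D (x * y) → p ∣D x ⊎ p ∣D y)

    prodV : ∀ {n} → Vec Carrier n → Carrier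
    prodV []       = 1#
    prodV (x ∷ xs) = x * prodV xs

    -- D (a subring of the field K, hence a domain) is a unique factorization domain:
    -- every nonzero nonunit is a product of irreducibles, uniquely up to
    -- order and associates.
    record IsUFD : Set (c ⊔ ℓ ⊔ ℓ') where
      field
        subring : IsSubring D
        factor  : ∀ x → D x → x ≉ 0# → ¬ UnitD x →
                  Σ[ n ∈ ℕ ] Σ[ ps ∈ Vec Carrier n ]
                    (VAll.All IrreducibleD ps × x ≈ prodV ps)
        unique  : ∀ {n k} (ps : Vec Carrier n) (qs : Vec Carrier k) →
                  VAll.All IrreducibleD ps → VAll.All IrreducibleD qs →
                  prodV ps ≈ prodV qs →
                  Σ[ σ ∈ (Fin n ↔ Fin k) ]
                    (∀ i → AssociatedD (lookup ps i) (lookup qs (Inverse.to σ i)))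

    AlgebraicOver : Carrier → Set (c ⊔ ℓ ⊔ ℓ')
    AlgebraicOver x = Σ[ cs ∈ List Carrier ]
      (All D cs × Any (λ a → a ≉ 0#) cs × evalPoly cs x ≈ 0#)

    CoprimeD : Carrier → Carrier → Set (c ⊔ ℓ ⊔ ℓ')
    CoprimeD x y = D x × D y × (∀ p → PrimeD p → ¬ (p ∣D x × p ∣D y))

-- Let p be a prime of D dividing A(a,b) and B(a,b), and put s = a + b. Since s² and ab lie in D and
-- a² = s a − ab, the ring D[a,b] is spanned over D by 1, s, a, s a, and each of its elements is a root of
-- a monic quadratic with coefficients in D + D s; hence an element of D lying in p·D[a,b] is divisible
-- by p in D. Cramer's rule for the Sylvester matrix writes Res(A,B)·a^(N−k) b^k, where N = m + n − 1, as
-- an integer combination of the multiples a^i b^j A(a,b) and a^i b^j B(a,b); as Res = ±1, this puts a^N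
-- and b^N into p·D[a,b]. So (ab)^N and (s²)^N = s^(2N) ∈ a^N D[a,b] + b^N D[a,b] are elements of D
-- divisible by p, and p divides both ab and s².
module Submission where

open import Defs
open import Algebra.Bundles using (CommutativeRing)
open import Data.Nat as ℕ using (ℕ; zero; suc; _<_; _≤_; z≤n; s≤s; _∸_)
import Data.Nat.Properties as ℕP
open import Data.Integer as ℤ using (ℤ; +_; -[1+_])
import Data.Integer.Properties as ℤP
open import Data.Fin as Fin using (Fin; toℕ; punchIn)
open import Data.Empty using (⊥-elim)
open import Data.Sum using (_⊎_; inj₁; inj₂)
open import Data.Product using (Σ-syntax; _×_; _,_; proj₁; proj₂; map₁)
open import Relation.Nullary using (¬_; yes; no)
open import Relation.Unary using (Pred)
open import Relation.Binary.PropositionalEquality as ≡ using (_≡_; _≢_)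

module Sums {c ℓ} (R : CommutativeRing c ℓ) where
  open CommutativeRing R
  open import Relation.Binary.Reasoning.Setoid setoid
  open import Algebra.Properties.CommutativeSemigroup +-commutativeSemigroup
    using (interchange)

  sum : ℕ → (ℕ → Carrier) → Carrier
  sum zero    f = 0#
  sum (suc n) f = f 0 + sum n (λ i → f (suc i))

  sum-cong : ∀ n {f g} → (∀ i → i < n → f i ≈ g i) → sum n f ≈ sum n g
  sum-cong zero    f≈g = refl
  sum-cong (suc n) f≈g =
    +-cong (f≈g 0 (s≤s z≤n)) (sum-cong n (λ i i<n → f≈g (suc i) (s≤s i<n)))

  sum-zero : ∀ n {f} → (∀ i → i < n → f i ≈ 0#) → sum n f ≈ 0#
  sum-zero n f≈0 = trans (sum-cong n f≈0) (zeros n)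
    where
    zeros : ∀ n → sum n (λ _ → 0#) ≈ 0#
    zeros zero    = refl
    zeros (suc n) = trans (+-identityˡ _) (zeros n)

  sum-+ : ∀ n f g → sum n (λ i → f i + g i) ≈ sum n f + sum n g
  sum-+ zero    f g = sym (+-identityˡ 0#)
  sum-+ (suc n) f g = trans (+-congˡ (sum-+ n _ _)) (interchange (f 0) (g 0) _ _)

  sum-*ˡ : ∀ n x f → x * sum n f ≈ sum n (λ i → x * f i)
  sum-*ˡ zero    x f = zeroʳ x
  sum-*ˡ (suc n) x f = trans (distribˡ x _ _) (+-congˡ (sum-*ˡ n x _))

  sum-*ʳ : ∀ n x f → sum n f * x ≈ sum n (λ i → f i * x)
  sum-*ʳ zero    x f = zeroˡ x
  sum-*ʳ (suc n) x f = trans (distribʳ x _ _) (+-congˡ (sum-*ʳ n x _))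

  sum-swap : ∀ m n (F : ℕ → ℕ → Carrier) →
    sum m (λ i → sum n (λ j → F i j)) ≈ sum n (λ j → sum m (λ i → F i j))
  sum-swap zero    n F = sym (sum-zero n (λ _ _ → refl))
  sum-swap (suc m) n F = trans (+-congˡ (sum-swap m n (λ i → F (suc i))))
    (sym (sum-+ n (F 0) (λ j → sum m (λ i → F (suc i) j))))

  sum-last : ∀ n f → sum (suc n) f ≈ sum n f + f n
  sum-last zero    f = trans (+-identityʳ (f 0)) (sym (+-identityˡ (f 0)))
  sum-last (suc n) f = trans (+-congˡ (sum-last n _)) (sym (+-assoc (f 0) _ _))

  sum-single : ∀ n c f → c < n → (∀ i → i < n → i ≢ c → f i ≈ 0#) → sum n f ≈ f c
  sum-single (suc n) zero f _ f≈0 =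
    trans (+-congˡ (sum-zero n (λ i i<n → f≈0 (suc i) (s≤s i<n) (λ ())))) (+-identityʳ _)
  sum-single (suc n) (suc c) f (s≤s c<n) f≈0 =
    trans (+-cong (f≈0 0 (s≤s z≤n) (λ ()))
                  (sum-single n c _ c<n (λ i i<n i≢c →
                     f≈0 (suc i) (s≤s i<n) (λ e → i≢c (ℕP.suc-injective e)))))
          (+-identityˡ _)

  sum-pair : ∀ n c f → suc c < n → (∀ i → i < n → i ≢ c → i ≢ suc c → f i ≈ 0#) →
    f c + f (suc c) ≈ 0# → sum n f ≈ 0#
  sum-pair (suc (suc n)) zero f _ f≈0 cancel = begin
    f 0 + (f 1 + sum n (λ i → f (suc (suc i))))
      ≈⟨ +-congˡ (+-congˡ (sum-zero n (λ i i<n → f≈0 (suc (suc i)) (s≤s (s≤s i<n)) (λ ()) (λ ())))) ⟩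
    f 0 + (f 1 + 0#)  ≈⟨ sym (+-assoc (f 0) (f 1) 0#) ⟩
    (f 0 + f 1) + 0#  ≈⟨ +-identityʳ _ ⟩
    f 0 + f 1         ≈⟨ cancel ⟩
    0#                ∎
  sum-pair (suc n) (suc c) f (s≤s c<n) f≈0 cancel =
    trans (+-cong (f≈0 0 (s≤s z≤n) (λ ()) (λ ()))
                  (sum-pair n c _ c<n (λ i i<n i≢c i≢sc → f≈0 (suc i) (s≤s i<n)
                     (λ e → i≢c (ℕP.suc-injective e)) (λ e → i≢sc (ℕP.suc-injective e))) cancel))
          (+-identityˡ 0#)

module IntegerDeterminant where
  open Sums ℤP.+-*-commutativeRing public using (sum)
  open Sums ℤP.+-*-commutativeRing using (sum-cong; sum-+; sum-*ˡ; sum-last; sum-pair)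
  open import Data.Integer.Solver using (module +-*-Solver)
  open +-*-Solver
  open import Data.Integer using (_+_; _*_; -_)
  open ≡ using (refl; sym; trans; cong; cong₂)
  open import Algebra.Properties.AbelianGroup ℤP.+-0-abelianGroup using (inverseʳ-unique)
  open import Relation.Binary.Definitions using (Tri; tri<; tri≈; tri>)

  -- Square matrices indexed by ℕ: one of size n is never read outside the indices below n.
  Matrix : Set
  Matrix = ℕ → ℕ → ℤ

  punchInℕ : ℕ → ℕ → ℕ
  punchInℕ zero    k       = suc k
  punchInℕ (suc j) zero    = zero
  punchInℕ (suc j) (suc k) = suc (punchInℕ j k)

  punchOutℕ : ℕ → ℕ → ℕ
  punchOutℕ zero    k       = ℕ.pred k
  punchOutℕ (suc j) zero    = zero
  punchOutℕ (suc j) (suc k) = suc (punchOutℕ j k)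

  punchInℕ-≢ : ∀ j k → punchInℕ j k ≢ j
  punchInℕ-≢ (suc j) (suc k) e = punchInℕ-≢ j k (ℕP.suc-injective e)

  punchInℕ-< : ∀ j k → k < j → punchInℕ j k ≡ k
  punchInℕ-< (suc j) zero    _         = refl
  punchInℕ-< (suc j) (suc k) (s≤s k<j) = cong suc (punchInℕ-< j k k<j)

  punchInℕ-≥ : ∀ j k → j ≤ k → punchInℕ j k ≡ suc k
  punchInℕ-≥ zero    k       _         = refl
  punchInℕ-≥ (suc j) (suc k) (s≤s j≤k) = cong suc (punchInℕ-≥ j k j≤k)

  punchInℕ-injective : ∀ j k k′ → punchInℕ j k ≡ punchInℕ j k′ → k ≡ k′
  punchInℕ-injective zero    k       k′       e = ℕP.suc-injective e
  punchInℕ-injective (suc j) zero    zero     e = refl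
  punchInℕ-injective (suc j) (suc k) (suc k′) e =
    cong suc (punchInℕ-injective j k k′ (ℕP.suc-injective e))

  punchInℕ-punchOutℕ : ∀ j k → k ≢ j → punchInℕ j (punchOutℕ j k) ≡ k
  punchInℕ-punchOutℕ zero    zero    k≢j = ⊥-elim (k≢j refl)
  punchInℕ-punchOutℕ zero    (suc k) k≢j = refl
  punchInℕ-punchOutℕ (suc j) zero    k≢j = refl
  punchInℕ-punchOutℕ (suc j) (suc k) k≢j = cong suc (punchInℕ-punchOutℕ j k (λ e → k≢j (cong suc e)))

  punchOutℕ-< : ∀ n j k → k < suc n → j < suc n → k ≢ j → punchOutℕ j k < n
  punchOutℕ-< n       zero    zero    _         _         k≢j = ⊥-elim (k≢j refl)
  punchOutℕ-< n       zero    (suc k) (s≤s k<n) _         _   = k<n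
  punchOutℕ-< zero    (suc j) k       _         (s≤s ())  _
  punchOutℕ-< (suc n) (suc j) zero    _         _         _   = s≤s z≤n
  punchOutℕ-< (suc n) (suc j) (suc k) (s≤s k<n) (s≤s j<n) k≢j =
    s≤s (punchOutℕ-< n j k k<n j<n (λ e → k≢j (cong suc e)))

  punchInℕ-suc : ∀ c k → k ≢ c → punchInℕ c k ≡ punchInℕ (suc c) k
  punchInℕ-suc zero    zero    k≢c = ⊥-elim (k≢c refl)
  punchInℕ-suc zero    (suc k) k≢c = refl
  punchInℕ-suc (suc c) zero    k≢c = refl
  punchInℕ-suc (suc c) (suc k) k≢c = cong suc (punchInℕ-suc c k (λ e → k≢c (cong suc e)))

  toℕ-punchIn : ∀ {n} (j : Fin (suc n)) (k : Fin n) → toℕ (punchIn j k) ≡ punchInℕ (toℕ j) (toℕ k)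
  toℕ-punchIn Fin.zero    k        = refl
  toℕ-punchIn (Fin.suc j) Fin.zero = refl
  toℕ-punchIn (Fin.suc j) (Fin.suc k) = cong suc (toℕ-punchIn j k)

  minor : Matrix → ℕ → Matrix
  minor M j i k = M (suc i) (punchInℕ j k)

  laplaceTerm : ℕ → Matrix → ℕ → ℤ
  determinant : ℕ → Matrix → ℤ

  laplaceTerm n M j = sgn j * (M 0 j * determinant n (minor M j))

  determinant zero    M = + 1
  determinant (suc n) M = sum (suc n) (laplaceTerm n M)

  sgn-suc : ∀ j → sgn (suc j) ≡ - sgn j
  sgn-suc zero          = refl
  sgn-suc (suc zero)    = refl
  sgn-suc (suc (suc j)) = sgn-suc j

  determinant-cong : ∀ n {M M′} → (∀ i k → i < n → M i k ≡ M′ i k) →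
    determinant n M ≡ determinant n M′
  determinant-cong zero    M≡M′ = refl
  determinant-cong (suc n) M≡M′ = sum-cong (suc n) λ j _ →
    cong₂ (λ x y → sgn j * (x * y)) (M≡M′ 0 j (s≤s z≤n))
      (determinant-cong n (λ i k i<n → M≡M′ (suc i) (punchInℕ j k) (s≤s i<n)))

  sumFin≡sum : ∀ n (f : Fin n → ℤ) g → (∀ i → f i ≡ g (toℕ i)) → sumFin n f ≡ sum n g
  sumFin≡sum zero    f g f≡g = refl
  sumFin≡sum (suc n) f g f≡g =
    cong₂ _+_ (f≡g Fin.zero) (sumFin≡sum n _ _ (λ i → f≡g (Fin.suc i)))

  det≡determinant : ∀ n (M : Fin n → Fin n → ℤ) (M̂ : Matrix) →
    (∀ i k → M i k ≡ M̂ (toℕ i) (toℕ k)) → det n M ≡ determinant n M̂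
  det≡determinant zero    M M̂ M≡M̂ = refl
  det≡determinant (suc n) M M̂ M≡M̂ = sumFin≡sum (suc n) _ (laplaceTerm n M̂) λ j →
    cong₂ (λ x y → sgn (toℕ j) * (x * y)) (M≡M̂ Fin.zero j)
      (det≡determinant n _ (minor M̂ (toℕ j))
        (λ i k → trans (M≡M̂ (Fin.suc i) (punchIn j k)) (cong (M̂ (suc (toℕ i))) (toℕ-punchIn j k))))

  ifEq : {A : Set} → ℕ → ℕ → A → A → A
  ifEq zero    zero    x y = x
  ifEq zero    (suc c) x y = y
  ifEq (suc k) zero    x y = y
  ifEq (suc k) (suc c) x y = ifEq k c x y

  ifEq-≡ : ∀ {A : Set} k (x y : A) → ifEq k k x y ≡ x
  ifEq-≡ zero    x y = refl
  ifEq-≡ (suc k) x y = ifEq-≡ k x y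

  ifEq-≢ : ∀ {A : Set} k c (x y : A) → k ≢ c → ifEq k c x y ≡ y
  ifEq-≢ zero    zero    x y k≢c = ⊥-elim (k≢c refl)
  ifEq-≢ zero    (suc c) x y k≢c = refl
  ifEq-≢ (suc k) zero    x y k≢c = refl
  ifEq-≢ (suc k) (suc c) x y k≢c = ifEq-≢ k c x y (λ e → k≢c (cong suc e))

  withCol : ℕ → (ℕ → ℤ) → Matrix → Matrix
  withCol c X M i k = ifEq k c (X i) (M i k)

  withCol-≡ : ∀ c X M i → withCol c X M i c ≡ X i
  withCol-≡ c X M i = ifEq-≡ c _ _

  withCol-≢ : ∀ c X M i k → k ≢ c → withCol c X M i k ≡ M i k
  withCol-≢ c X M i k k≢c = ifEq-≢ k c _ _ k≢c

  AgreeOffCol : ℕ → Matrix → Matrix → Set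
  AgreeOffCol c M M′ = ∀ i k → k ≢ c → M i k ≡ M′ i k

  withCol-agreeOffCol : ∀ c X Y M → AgreeOffCol c (withCol c X M) (withCol c Y M)
  withCol-agreeOffCol c X Y M i k k≢c = trans (withCol-≢ c X M i k k≢c) (sym (withCol-≢ c Y M i k k≢c))

  minor-agreeOffCol-≡ : ∀ c {M M′} → AgreeOffCol c M M′ → ∀ i k → minor M c i k ≡ minor M′ c i k
  minor-agreeOffCol-≡ c M≈M′ i k = M≈M′ (suc i) (punchInℕ c k) (punchInℕ-≢ c k)

  minor-agreeOffCol-≢ : ∀ j c {M M′} → c ≢ j → AgreeOffCol c M M′ →
    AgreeOffCol (punchOutℕ j c) (minor M j) (minor M′ j)
  minor-agreeOffCol-≢ j c c≢j M≈M′ i k k≢ = M≈M′ (suc i) (punchInℕ j k)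
    λ e → k≢ (punchInℕ-injective j k _ (trans e (sym (punchInℕ-punchOutℕ j c c≢j))))

  minor-punchOutℕ : ∀ j c (M : Matrix) i → c ≢ j → minor M j i (punchOutℕ j c) ≡ M (suc i) c
  minor-punchOutℕ j c M i c≢j = cong (M (suc i)) (punchInℕ-punchOutℕ j c c≢j)

  determinant-linear : ∀ n c x y {M₁ M₂ M} → c < n →
    AgreeOffCol c M₁ M → AgreeOffCol c M₂ M → (∀ i → M i c ≡ x * M₁ i c + y * M₂ i c) →
    determinant n M ≡ x * determinant n M₁ + y * determinant n M₂
  determinant-linear (suc n) c x y {M₁} {M₂} {M} c<n M₁≈M M₂≈M col-c = begin
    sum (suc n) (laplaceTerm n M)
      ≡⟨ sum-cong (suc n) term-linear ⟩
    sum (suc n) (λ j → x * laplaceTerm n M₁ j + y * laplaceTerm n M₂ j)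
      ≡⟨ sum-+ (suc n) (λ j → x * laplaceTerm n M₁ j) (λ j → y * laplaceTerm n M₂ j) ⟩
    sum (suc n) (λ j → x * laplaceTerm n M₁ j) + sum (suc n) (λ j → y * laplaceTerm n M₂ j)
      ≡⟨ sym (cong₂ _+_ (sum-*ˡ (suc n) x (laplaceTerm n M₁)) (sum-*ˡ (suc n) y (laplaceTerm n M₂))) ⟩
    x * determinant (suc n) M₁ + y * determinant (suc n) M₂ ∎
    where
    open ≡.≡-Reasoning
    distrib-entry : ∀ s m₁ m₂ d → s * ((x * m₁ + y * m₂) * d) ≡ x * (s * (m₁ * d)) + y * (s * (m₂ * d))
    distrib-entry = solve 6 (λ x y s m₁ m₂ d →
      s :* ((x :* m₁ :+ y :* m₂) :* d) := x :* (s :* (m₁ :* d)) :+ y :* (s :* (m₂ :* d))) refl x y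
    distrib-minor : ∀ s m d₁ d₂ → s * (m * (x * d₁ + y * d₂)) ≡ x * (s * (m * d₁)) + y * (s * (m * d₂))
    distrib-minor = solve 6 (λ x y s m d₁ d₂ →
      s :* (m :* (x :* d₁ :+ y :* d₂)) := x :* (s :* (m :* d₁)) :+ y :* (s :* (m :* d₂))) refl x y
    term-linear : ∀ j → j < suc n → laplaceTerm n M j ≡ x * laplaceTerm n M₁ j + y * laplaceTerm n M₂ j
    term-linear j j<n with j ℕ.≟ c
    ... | yes refl = begin
      sgn j * (M 0 j * determinant n (minor M j))
        ≡⟨ cong (λ m → sgn j * (m * determinant n (minor M j))) (col-c 0) ⟩
      sgn j * ((x * M₁ 0 j + y * M₂ 0 j) * determinant n (minor M j))
        ≡⟨ distrib-entry (sgn j) (M₁ 0 j) (M₂ 0 j) _ ⟩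
      x * (sgn j * (M₁ 0 j * determinant n (minor M j))) + y * (sgn j * (M₂ 0 j * determinant n (minor M j)))
        ≡⟨ sym (cong₂ (λ d₁ d₂ → x * (sgn j * (M₁ 0 j * d₁)) + y * (sgn j * (M₂ 0 j * d₂)))
             (determinant-cong n (λ i k _ → minor-agreeOffCol-≡ j M₁≈M i k))
             (determinant-cong n (λ i k _ → minor-agreeOffCol-≡ j M₂≈M i k))) ⟩
      x * laplaceTerm n M₁ j + y * laplaceTerm n M₂ j ∎
    ... | no j≢c = begin
      sgn j * (M 0 j * determinant n (minor M j))
        ≡⟨ cong (λ d → sgn j * (M 0 j * d)) minor-linear ⟩
      sgn j * (M 0 j * (x * determinant n (minor M₁ j) + y * determinant n (minor M₂ j)))
        ≡⟨ distrib-minor (sgn j) (M 0 j) _ _ ⟩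
      x * (sgn j * (M 0 j * determinant n (minor M₁ j))) + y * (sgn j * (M 0 j * determinant n (minor M₂ j)))
        ≡⟨ sym (cong₂ (λ m₁ m₂ → x * (sgn j * (m₁ * determinant n (minor M₁ j)))
                                 + y * (sgn j * (m₂ * determinant n (minor M₂ j))))
             (M₁≈M 0 j j≢c) (M₂≈M 0 j j≢c)) ⟩
      x * laplaceTerm n M₁ j + y * laplaceTerm n M₂ j ∎
      where
      c≢j : c ≢ j
      c≢j e = j≢c (sym e)
      minor-linear : determinant n (minor M j) ≡ x * determinant n (minor M₁ j) + y * determinant n (minor M₂ j)
      minor-linear = determinant-linear n (punchOutℕ j c) x y (punchOutℕ-< n j c c<n j<n c≢j)
        (minor-agreeOffCol-≢ j c c≢j M₁≈M) (minor-agreeOffCol-≢ j c c≢j M₂≈M)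
        (λ i → trans (minor-punchOutℕ j c M i c≢j)
                 (trans (col-c (suc i)) (sym (cong₂ (λ u v → x * u + y * v)
                   (minor-punchOutℕ j c M₁ i c≢j) (minor-punchOutℕ j c M₂ i c≢j)))))

  determinant-additive : ∀ n c {M₁ M₂ M} → c < n →
    AgreeOffCol c M₁ M → AgreeOffCol c M₂ M → (∀ i → M i c ≡ M₁ i c + M₂ i c) →
    determinant n M ≡ determinant n M₁ + determinant n M₂
  determinant-additive n c {M₁} {M₂} {M} c<n M₁≈M M₂≈M col-c =
    trans (determinant-linear n c (+ 1) (+ 1) c<n M₁≈M M₂≈M
            (λ i → trans (col-c i) (sym (cong₂ _+_ (ℤP.*-identityˡ (M₁ i c)) (ℤP.*-identityˡ (M₂ i c))))))
          (cong₂ _+_ (ℤP.*-identityˡ (determinant n M₁)) (ℤP.*-identityˡ (determinant n M₂)))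

  determinant-adjacent-equal-cols : ∀ n c M → suc c < n → (∀ i → M i c ≡ M i (suc c)) →
    determinant n M ≡ + 0
  determinant-adjacent-equal-cols (suc n) c M sc<n cols≡ =
    sum-pair (suc n) c (laplaceTerm n M) sc<n other-terms-vanish pair-cancels
    where
    open ≡.≡-Reasoning
    term-vanishes : ∀ j → determinant n (minor M j) ≡ + 0 → laplaceTerm n M j ≡ + 0
    term-vanishes j d≡0 = trans (cong (λ d → sgn j * (M 0 j * d)) d≡0)
      (trans (cong (sgn j *_) (ℤP.*-zeroʳ (M 0 j))) (ℤP.*-zeroʳ (sgn j)))
    other-terms-vanish : ∀ j → j < suc n → j ≢ c → j ≢ suc c → laplaceTerm n M j ≡ + 0
    other-terms-vanish j j<n j≢c j≢sc with ℕP.<-cmp j c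
    ... | tri≈ _ j≡c _ = ⊥-elim (j≢c j≡c)
    ... | tri> _ _ c<j = term-vanishes j
      (determinant-adjacent-equal-cols n c (minor M j) (ℕP.<-≤-trans sc<j (ℕP.≤-pred j<n))
        (λ i → trans (cong (M (suc i)) (punchInℕ-< j c c<j))
                 (trans (cols≡ (suc i)) (cong (M (suc i)) (sym (punchInℕ-< j (suc c) sc<j))))))
      where
      sc<j : suc c < j
      sc<j = ℕP.≤∧≢⇒< c<j (λ e → j≢sc (sym e))
    ... | tri< j<c _ _ = term-vanishes j (minor-below j<c sc<n cols≡)
      where
      minor-below : ∀ {j c′} → j < c′ → suc c′ < suc n → (∀ i → M i c′ ≡ M i (suc c′)) →
        determinant n (minor M j) ≡ + 0
      minor-below {j} {suc c₀} (s≤s j≤c₀) (s≤s sc₀<n) cols′≡ =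
        determinant-adjacent-equal-cols n c₀ (minor M j) sc₀<n
          (λ i → trans (cong (M (suc i)) (punchInℕ-≥ j c₀ j≤c₀))
                   (trans (cols′≡ (suc i))
                     (cong (M (suc i)) (sym (punchInℕ-≥ j (suc c₀) (ℕP.m≤n⇒m≤1+n j≤c₀))))))
    minors≡ : ∀ i k → minor M c i k ≡ minor M (suc c) i k
    minors≡ i k with k ℕ.≟ c
    ... | yes refl = trans (cong (M (suc i)) (punchInℕ-≥ k k ℕP.≤-refl))
                      (trans (sym (cols≡ (suc i))) (cong (M (suc i)) (sym (punchInℕ-< (suc k) k (ℕP.n<1+n k)))))
    ... | no k≢c = cong (M (suc i)) (punchInℕ-suc c k k≢c)
    pair-cancels : laplaceTerm n M c + laplaceTerm n M (suc c) ≡ + 0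
    pair-cancels = begin
      laplaceTerm n M c + sgn (suc c) * (M 0 (suc c) * determinant n (minor M (suc c)))
        ≡⟨ cong₂ (λ s t → laplaceTerm n M c + s * t) (sgn-suc c)
             (cong₂ _*_ (sym (cols≡ 0)) (sym (determinant-cong n (λ i k _ → minors≡ i k)))) ⟩
      laplaceTerm n M c + - sgn c * (M 0 c * determinant n (minor M c))
        ≡⟨ solve 2 (λ s t → s :* t :+ :- s :* t := con (+ 0)) refl (sgn c) _ ⟩
      + 0 ∎

  swapCols : ℕ → Matrix → Matrix
  swapCols c M = withCol c (λ i → M i (suc c)) (withCol (suc c) (λ i → M i c) M)

  swapCols-≡ : ∀ c M i → swapCols c M i c ≡ M i (suc c)
  swapCols-≡ c M i = withCol-≡ c (λ i → M i (suc c)) (withCol (suc c) (λ i → M i c) M) i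

  swapCols-≢ : ∀ c M i k → k ≢ c → k ≢ suc c → swapCols c M i k ≡ M i k
  swapCols-≢ c M i k k≢c k≢sc =
    trans (withCol-≢ c (λ i → M i (suc c)) (withCol (suc c) (λ i → M i c) M) i k k≢c)
          (withCol-≢ (suc c) (λ i → M i c) M i k k≢sc)

  -- With Q U V the matrix M with columns c, c + 1 replaced by U, V, bilinearity and alternation give
  -- 0 = det Q(X + Y, X + Y) = det Q(X, Y) + det Q(Y, X).
  determinant-swapCols : ∀ n c M → suc c < n → determinant n (swapCols c M) ≡ - determinant n M
  determinant-swapCols n c M sc<n =
    inverseʳ-unique (determinant n M) _ (trans (cong (_+ determinant n (Q Y X)) M≡QXY) sum≡0)
    where
    open ≡.≡-Reasoning
    X Y X+Y : ℕ → ℤ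
    X i = M i c
    Y i = M i (suc c)
    X+Y i = X i + Y i
    Q : (ℕ → ℤ) → (ℕ → ℤ) → Matrix
    Q U V = withCol c U (withCol (suc c) V M)
    c<n : c < n
    c<n = ℕP.<-trans (ℕP.n<1+n c) sc<n
    c≢sc : c ≢ suc c
    c≢sc e = ℕP.<-irrefl e (ℕP.n<1+n c)
    Q-c : ∀ U V i → Q U V i c ≡ U i
    Q-c U V i = withCol-≡ c U (withCol (suc c) V M) i
    Q-sc : ∀ U V i → Q U V i (suc c) ≡ V i
    Q-sc U V i = trans (withCol-≢ c U (withCol (suc c) V M) i (suc c) (λ e → c≢sc (sym e)))
                       (withCol-≡ (suc c) V M i)
    Q-agree-sc : ∀ U V V′ → AgreeOffCol (suc c) (Q U V) (Q U V′)
    Q-agree-sc U V V′ i k k≢sc = cong (ifEq k c (U i)) (withCol-agreeOffCol (suc c) V V′ M i k k≢sc)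
    Q-same-vanishes : ∀ U → determinant n (Q U U) ≡ + 0
    Q-same-vanishes U =
      determinant-adjacent-equal-cols n c (Q U U) sc<n (λ i → trans (Q-c U U i) (sym (Q-sc U U i)))
    linear-c : ∀ V → determinant n (Q X+Y V) ≡ determinant n (Q X V) + determinant n (Q Y V)
    linear-c V = determinant-additive n c c<n (withCol-agreeOffCol c _ _ _) (withCol-agreeOffCol c _ _ _)
      (λ i → trans (Q-c X+Y V i) (sym (cong₂ _+_ (Q-c X V i) (Q-c Y V i))))
    linear-sc : ∀ U → determinant n (Q U X+Y) ≡ determinant n (Q U X) + determinant n (Q U Y)
    linear-sc U = determinant-additive n (suc c) sc<n (Q-agree-sc U _ _) (Q-agree-sc U _ _)
      (λ i → trans (Q-sc U X+Y i) (sym (cong₂ _+_ (Q-sc U X i) (Q-sc U Y i))))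
    M≡QXY : determinant n M ≡ determinant n (Q X Y)
    M≡QXY = determinant-cong n λ i k _ → sym (Q-is-M i k)
      where
      Q-is-M : ∀ i k → Q X Y i k ≡ M i k
      Q-is-M i k with k ℕ.≟ c | k ℕ.≟ suc c
      ... | yes refl | _        = Q-c X Y i
      ... | no _     | yes refl = Q-sc X Y i
      ... | no k≢c   | no k≢sc  = trans (withCol-≢ c X (withCol (suc c) Y M) i k k≢c)
                                         (withCol-≢ (suc c) Y M i k k≢sc)
    sum≡0 : determinant n (Q X Y) + determinant n (Q Y X) ≡ + 0
    sum≡0 = begin
      determinant n (Q X Y) + determinant n (Q Y X)
        ≡⟨ solve 2 (λ d d′ → d :+ d′ := (con (+ 0) :+ d) :+ (d′ :+ con (+ 0))) refl (determinant n (Q X Y)) _ ⟩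
      (+ 0 + determinant n (Q X Y)) + (determinant n (Q Y X) + + 0)
        ≡⟨ cong₂ (λ u v → (u + determinant n (Q X Y)) + (determinant n (Q Y X) + v))
             (sym (Q-same-vanishes X)) (sym (Q-same-vanishes Y)) ⟩
      (determinant n (Q X X) + determinant n (Q X Y)) + (determinant n (Q Y X) + determinant n (Q Y Y))
        ≡⟨ sym (cong₂ _+_ (linear-sc X) (linear-sc Y)) ⟩
      determinant n (Q X X+Y) + determinant n (Q Y X+Y)
        ≡⟨ sym (linear-c X+Y) ⟩
      determinant n (Q X+Y X+Y)
        ≡⟨ Q-same-vanishes X+Y ⟩
      + 0 ∎

  determinant-equal-cols : ∀ n c d M → c < d → d < n → (∀ i → M i c ≡ M i d) → determinant n M ≡ + 0
  determinant-equal-cols n c (suc d) M c<sd sd<n cols≡ with c ℕ.≟ d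
  ... | yes refl = determinant-adjacent-equal-cols n c M sd<n cols≡
  ... | no c≢d = begin
    determinant n M                  ≡⟨ sym (ℤP.neg-involutive _) ⟩
    - - determinant n M              ≡⟨ cong -_ (sym (determinant-swapCols n d M sd<n)) ⟩
    - determinant n (swapCols d M)   ≡⟨ cong -_ swapped-vanishes ⟩
    + 0                              ∎
    where
    open ≡.≡-Reasoning
    swapped-vanishes : determinant n (swapCols d M) ≡ + 0
    swapped-vanishes = determinant-equal-cols n c d (swapCols d M)
      (ℕP.≤∧≢⇒< (ℕP.≤-pred c<sd) c≢d) (ℕP.<-trans (ℕP.n<1+n d) sd<n)
      (λ i → trans (swapCols-≢ d M i c c≢d (λ e → ℕP.<-irrefl e c<sd))
               (trans (cols≡ i) (sym (swapCols-≡ d M i))))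

  basis : ℕ → ℕ → ℤ
  basis r i = ifEq i r (+ 1) (+ 0)

  cofactor : ℕ → Matrix → ℕ → ℕ → ℤ
  cofactor n M c r = determinant n (withCol c (basis r) M)

  truncate : ℕ → (ℕ → ℤ) → ℕ → ℤ
  truncate zero    X i = + 0
  truncate (suc t) X i = ifEq i t (X t) (truncate t X i)

  truncate-≥ : ∀ t X i → t ≤ i → truncate t X i ≡ + 0
  truncate-≥ zero    X i _   = refl
  truncate-≥ (suc t) X i t<i =
    trans (ifEq-≢ i t _ _ (λ e → ℕP.<-irrefl (sym e) t<i)) (truncate-≥ t X i (ℕP.<⇒≤ t<i))

  truncate-< : ∀ t X i → i < t → truncate t X i ≡ X i
  truncate-< (suc t) X i i<st with i ℕ.≟ t
  ... | yes refl = ifEq-≡ i _ _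
  ... | no i≢t  = trans (ifEq-≢ i t _ _ i≢t) (truncate-< t X i (ℕP.≤∧≢⇒< (ℕP.≤-pred i<st) i≢t))

  truncate-suc : ∀ t X i → truncate (suc t) X i ≡ + 1 * truncate t X i + X t * basis t i
  truncate-suc t X i with i ℕ.≟ t
  ... | yes refl = begin
    ifEq i i (X i) (truncate i X i)          ≡⟨ ifEq-≡ i _ _ ⟩
    X i                                      ≡⟨ solve 1 (λ x → x := con (+ 1) :* con (+ 0) :+ x :* con (+ 1)) refl (X i) ⟩
    + 1 * + 0 + X i * + 1                    ≡⟨ sym (cong₂ (λ u v → + 1 * u + X i * v)
                                                  (truncate-≥ i X i ℕP.≤-refl) (ifEq-≡ i _ _)) ⟩
    + 1 * truncate i X i + X i * basis i i   ∎
    where open ≡.≡-Reasoning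
  ... | no i≢t = begin
    ifEq i t (X t) (truncate t X i)          ≡⟨ ifEq-≢ i t _ _ i≢t ⟩
    truncate t X i                           ≡⟨ solve 2 (λ y x → y := con (+ 1) :* y :+ x :* con (+ 0)) refl _ (X t) ⟩
    + 1 * truncate t X i + X t * + 0         ≡⟨ sym (cong (λ v → + 1 * truncate t X i + X t * v) (ifEq-≢ i t _ _ i≢t)) ⟩
    + 1 * truncate t X i + X t * basis t i   ∎
    where open ≡.≡-Reasoning

  determinant-withCol : ∀ n c M X → c < n →
    determinant n (withCol c X M) ≡ sum n (λ r → X r * cofactor n M c r)
  determinant-withCol n c M X c<n =
    trans (determinant-cong n (λ i k i<n → cong (λ z → ifEq k c z (M i k)) (sym (truncate-< n X i i<n))))
          (expand n)
    where
    open ≡.≡-Reasoning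
    expand : ∀ t → determinant n (withCol c (truncate t X) M) ≡ sum t (λ r → X r * cofactor n M c r)
    expand zero = begin
      determinant n M₀
        ≡⟨ determinant-linear n c (+ 0) (+ 0) c<n (λ _ _ _ → refl) (λ _ _ _ → refl) (λ i → withCol-≡ c _ M i) ⟩
      + 0 * determinant n M₀ + + 0 * determinant n M₀
        ≡⟨ solve 1 (λ d → con (+ 0) :* d :+ con (+ 0) :* d := con (+ 0)) refl (determinant n M₀) ⟩
      + 0 ∎
      where
      M₀ : Matrix
      M₀ = withCol c (truncate 0 X) M
    expand (suc t) = begin
      determinant n (withCol c (truncate (suc t) X) M)
        ≡⟨ determinant-linear n c (+ 1) (X t) c<n (withCol-agreeOffCol c _ _ M) (withCol-agreeOffCol c _ _ M)
             (λ i → trans (withCol-≡ c (truncate (suc t) X) M i)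
                      (trans (truncate-suc t X i) (sym (cong₂ (λ u v → + 1 * u + X t * v)
                        (withCol-≡ c (truncate t X) M i) (withCol-≡ c (basis t) M i))))) ⟩
      + 1 * determinant n (withCol c (truncate t X) M) + X t * cofactor n M c t
        ≡⟨ cong (_+ X t * cofactor n M c t) (trans (ℤP.*-identityˡ _) (expand t)) ⟩
      sum t (λ r → X r * cofactor n M c r) + X t * cofactor n M c t
        ≡⟨ sym (sum-last t (λ r → X r * cofactor n M c r)) ⟩
      sum (suc t) (λ r → X r * cofactor n M c r) ∎

  determinant-withCol-col : ∀ n c k M → c < n → k < n →
    determinant n (withCol c (λ i → M i k) M) ≡ ifEq k c (determinant n M) (+ 0)
  determinant-withCol-col n c k M c<n k<n with k ℕ.≟ c
  ... | yes refl = trans (determinant-cong n (λ i k′ _ → unchanged i k′)) (sym (ifEq-≡ k _ _))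
    where
    unchanged : ∀ i k′ → withCol k (λ i → M i k) M i k′ ≡ M i k′
    unchanged i k′ with k′ ℕ.≟ k
    ... | yes refl = withCol-≡ k′ (λ i → M i k′) M i
    ... | no k′≢k  = withCol-≢ k (λ i → M i k) M i k′ k′≢k
  ... | no k≢c = trans (two-equal-cols (ℕP.<-cmp c k)) (sym (ifEq-≢ k c _ _ k≢c))
    where
    N : Matrix
    N = withCol c (λ i → M i k) M
    col-k≡col-c : ∀ i → N i k ≡ N i c
    col-k≡col-c i = trans (withCol-≢ c (λ i → M i k) M i k k≢c) (sym (withCol-≡ c (λ i → M i k) M i))
    two-equal-cols : Tri (c < k) (c ≡ k) (k < c) → determinant n N ≡ + 0
    two-equal-cols (tri< c<k _ _) = determinant-equal-cols n c k N c<k k<n (λ i → sym (col-k≡col-c i))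
    two-equal-cols (tri≈ _ c≡k _) = ⊥-elim (k≢c (sym c≡k))
    two-equal-cols (tri> _ _ k<c) = determinant-equal-cols n k c N k<c c<n col-k≡col-c

  cofactor-expansion : ∀ n c k M → c < n → k < n →
    sum n (λ r → M r k * cofactor n M c r) ≡ ifEq k c (determinant n M) (+ 0)
  cofactor-expansion n c k M c<n k<n =
    trans (sym (determinant-withCol n c M (λ r → M r k) c<n)) (determinant-withCol-col n c k M c<n k<n)

module IntegerEmbedding {c ℓ} (K : CommutativeRing c ℓ) where
  open CommutativeRing K
  open import Relation.Binary.Reasoning.Setoid setoid
  open import Data.Sign as Sign using (Sign)
  open import Data.Maybe using (Maybe; just; nothing)
  open import Algebra.Properties.Ring ring using (-‿distribʳ-*; -0#≈0#; -1*x≈-x)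
  open import Algebra.Properties.AbelianGroup +-abelianGroup using (⁻¹-∙-comm; ⁻¹-involutive)
  open import Algebra.Properties.CommutativeSemigroup +-commutativeSemigroup
    using () renaming (interchange to +-interchange)
  open import Algebra.Properties.CommutativeSemigroup *-commutativeSemigroup
    using () renaming (interchange to *-interchange)
  import Algebra.Solver.Ring.AlmostCommutativeRing as ACR
  import Algebra.Solver.Ring

  nK : ℕ → Carrier
  nK = natK K

  iK : ℤ → Carrier
  iK = intK K

  natK-+ : ∀ m n → nK (m ℕ.+ n) ≈ nK m + nK n
  natK-+ zero    n = sym (+-identityˡ _)
  natK-+ (suc m) n = trans (+-congˡ (natK-+ m n)) (sym (+-assoc 1# (nK m) (nK n)))

  natK-* : ∀ m n → nK (m ℕ.* n) ≈ nK m * nK n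
  natK-* zero    n = sym (zeroˡ _)
  natK-* (suc m) n = begin
    nK (n ℕ.+ m ℕ.* n)          ≈⟨ natK-+ n (m ℕ.* n) ⟩
    nK n + nK (m ℕ.* n)         ≈⟨ +-cong (sym (*-identityˡ _)) (natK-* m n) ⟩
    1# * nK n + nK m * nK n     ≈⟨ sym (distribʳ _ _ _) ⟩
    (1# + nK m) * nK n          ∎

  intK-⊖ : ∀ m n → iK (m ℤ.⊖ n) ≈ nK m - nK n
  intK-⊖ m zero = begin
    iK (m ℤ.⊖ 0)   ≈⟨ reflexive (≡.cong iK (ℤP.⊖-≥ {m} z≤n)) ⟩
    nK m           ≈⟨ sym (+-identityʳ _) ⟩
    nK m + 0#      ≈⟨ +-congˡ (sym -0#≈0#) ⟩
    nK m - 0#      ∎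
  intK-⊖ zero (suc n) = begin
    iK (0 ℤ.⊖ suc n) ≈⟨ reflexive (≡.cong iK (ℤP.⊖-< {0} {suc n} ℕ.z<s)) ⟩
    - nK (suc n)     ≈⟨ sym (+-identityˡ _) ⟩
    0# - nK (suc n)  ∎
  intK-⊖ (suc m) (suc n) = begin
    iK (suc m ℤ.⊖ suc n)       ≈⟨ reflexive (≡.cong iK (ℤP.[1+m]⊖[1+n]≡m⊖n m n)) ⟩
    iK (m ℤ.⊖ n)               ≈⟨ intK-⊖ m n ⟩
    nK m - nK n                ≈⟨ sym (+-identityˡ _) ⟩
    0# + (nK m - nK n)         ≈⟨ +-congʳ (sym (-‿inverseʳ 1#)) ⟩
    (1# - 1#) + (nK m - nK n)  ≈⟨ +-interchange 1# (- 1#) (nK m) (- nK n) ⟩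
    (1# + nK m) + (- 1# - nK n) ≈⟨ +-congˡ (⁻¹-∙-comm 1# (nK n)) ⟩
    (1# + nK m) - (1# + nK n)  ∎

  intK-+ : ∀ i j → iK (i ℤ.+ j) ≈ iK i + iK j
  intK-+ (+ m)    (+ n)    = natK-+ m n
  intK-+ (+ m)    -[1+ n ] = intK-⊖ m (suc n)
  intK-+ -[1+ m ] (+ n)    = trans (intK-⊖ n (suc m)) (+-comm _ _)
  intK-+ -[1+ m ] -[1+ n ] = begin
    - nK (suc (suc (m ℕ.+ n)))      ≈⟨ -‿cong (reflexive (≡.cong nK (≡.sym (ℕP.+-suc (suc m) n)))) ⟩
    - nK (suc m ℕ.+ suc n)          ≈⟨ -‿cong (natK-+ (suc m) (suc n)) ⟩
    - (nK (suc m) + nK (suc n))     ≈⟨ sym (⁻¹-∙-comm _ _) ⟩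
    - nK (suc m) + - nK (suc n)     ∎

  signK : Sign → Carrier
  signK Sign.+ = 1#
  signK Sign.- = - 1#

  signK-* : ∀ s t → signK (s Sign.* t) ≈ signK s * signK t
  signK-* Sign.+ Sign.+ = sym (*-identityˡ _)
  signK-* Sign.+ Sign.- = sym (*-identityˡ _)
  signK-* Sign.- Sign.+ = sym (*-identityʳ _)
  signK-* Sign.- Sign.- = begin
    1#                ≈⟨ sym (⁻¹-involutive 1#) ⟩
    - - 1#            ≈⟨ -‿cong (sym (-1*x≈-x 1#)) ⟩
    - (- 1# * 1#)     ≈⟨ -‿distribʳ-* _ _ ⟩
    - 1# * - 1#       ∎

  intK-◃ : ∀ s n → iK (s ℤ.◃ n) ≈ signK s * nK n
  intK-◃ s      zero    = sym (zeroʳ _)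
  intK-◃ Sign.+ (suc n) = sym (*-identityˡ _)
  intK-◃ Sign.- (suc n) = sym (-1*x≈-x _)

  intK-sign-abs : ∀ i → iK i ≈ signK (ℤ.sign i) * nK ℤ.∣ i ∣
  intK-sign-abs i = trans (reflexive (≡.cong iK (≡.sym (ℤP.◃-inverse i)))) (intK-◃ (ℤ.sign i) ℤ.∣ i ∣)

  intK-* : ∀ i j → iK (i ℤ.* j) ≈ iK i * iK j
  intK-* i j = begin
    iK (i ℤ.* j)
      ≈⟨ intK-◃ (ℤ.sign i Sign.* ℤ.sign j) (ℤ.∣ i ∣ ℕ.* ℤ.∣ j ∣) ⟩
    signK (ℤ.sign i Sign.* ℤ.sign j) * nK (ℤ.∣ i ∣ ℕ.* ℤ.∣ j ∣)
      ≈⟨ *-cong (signK-* (ℤ.sign i) (ℤ.sign j)) (natK-* ℤ.∣ i ∣ ℤ.∣ j ∣) ⟩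
    (signK (ℤ.sign i) * signK (ℤ.sign j)) * (nK ℤ.∣ i ∣ * nK ℤ.∣ j ∣)
      ≈⟨ *-interchange _ _ _ _ ⟩
    (signK (ℤ.sign i) * nK ℤ.∣ i ∣) * (signK (ℤ.sign j) * nK ℤ.∣ j ∣)
      ≈⟨ sym (*-cong (intK-sign-abs i) (intK-sign-abs j)) ⟩
    iK i * iK j ∎

  intK-neg : ∀ i → iK (ℤ.- i) ≈ - iK i
  intK-neg -[1+ n ]   = sym (⁻¹-involutive _)
  intK-neg (+ zero)   = sym -0#≈0#
  intK-neg (+ suc n)  = refl

  intK-1 : iK (+ 1) ≈ 1#
  intK-1 = +-identityʳ 1#

  intK-sum : ∀ n f → iK (IntegerDeterminant.sum n f) ≈ Sums.sum K n (λ i → iK (f i))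
  intK-sum zero    f = refl
  intK-sum (suc n) f = trans (intK-+ (f 0) _) (+-congˡ (intK-sum n _))

  intK-homomorphism :
    CommutativeRing.rawRing ℤP.+-*-commutativeRing ACR.-Raw-AlmostCommutative⟶ ACR.fromCommutativeRing K
  intK-homomorphism = record
    { ⟦_⟧ = iK ; +-homo = intK-+ ; *-homo = intK-* ; -‿homo = intK-neg ; 0-homo = refl ; 1-homo = intK-1 }

  intK-≟ : ∀ x y → Maybe (iK x ≈ iK y)
  intK-≟ x y with x ℤ.≟ y
  ... | yes ≡.refl = just refl
  ... | no _       = nothing

  module Solver = Algebra.Solver.Ring (CommutativeRing.rawRing ℤP.+-*-commutativeRing)
    (ACR.fromCommutativeRing K) intK-homomorphism intK-≟

module Cramer {c ℓ} (K : CommutativeRing c ℓ) where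
  open import Level using (_⊔_)
  open CommutativeRing K
  open import Relation.Binary.Reasoning.Setoid setoid
  open IntegerEmbedding K using (iK; intK-*; intK-1; intK-sum)
  open IntegerDeterminant using (Matrix; determinant; cofactor; cofactor-expansion; ifEq; ifEq-≡; ifEq-≢)
  open Sums K

  record IsℤSubmodule {ℓi} (I : Pred Carrier ℓi) : Set (c ⊔ ℓ ⊔ ℓi) where
    field
      ∈-resp-≈ : ∀ {x y} → x ≈ y → I x → I y
      0∈      : I 0#
      +-∈     : ∀ {x y} → I x → I y → I (x + y)
      ℤ*-∈    : ∀ z {x} → I x → I (iK z * x)

    sum-∈ : ∀ n f → (∀ i → i < n → I (f i)) → I (sum n f)
    sum-∈ zero    f f∈ = 0∈
    sum-∈ (suc n) f f∈ = +-∈ (f∈ 0 (s≤s z≤n)) (sum-∈ n _ (λ i i<n → f∈ (suc i) (s≤s i<n)))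

    ±1*-∈⁻¹ : ∀ z {x} → z ≡ + 1 ⊎ z ≡ ℤ.- (+ 1) → I (iK z * x) → I x
    ±1*-∈⁻¹ z {x} (inj₁ ≡.refl) zx∈ = ∈-resp-≈ (trans (*-congʳ intK-1) (*-identityˡ x)) zx∈
    ±1*-∈⁻¹ z {x} (inj₂ ≡.refl) zx∈ = ∈-resp-≈ square-cancels (ℤ*-∈ (ℤ.- (+ 1)) zx∈)
      where
      square-cancels : iK (ℤ.- (+ 1)) * (iK (ℤ.- (+ 1)) * x) ≈ x
      square-cancels = trans (sym (*-assoc _ _ _))
        (trans (*-congʳ (sym (intK-* (ℤ.- (+ 1)) (ℤ.- (+ 1))))) (trans (*-congʳ intK-1) (*-identityˡ x)))

  module _ {ℓi} {I : Pred Carrier ℓi} (isI : IsℤSubmodule I) where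
    open IsℤSubmodule isI

    cramer : ∀ n (M : Matrix) c → c < n → (v : ℕ → Carrier) →
      (∀ r → r < n → I (sum n (λ k → iK (M r k) * v k))) → I (iK (determinant n M) * v c)
    cramer n M c c<n v rows∈ = ∈-resp-≈ combination≈ (sum-∈ n _ (λ r r<n → ℤ*-∈ (w r) (rows∈ r r<n)))
      where
      w : ℕ → ℤ
      w = cofactor n M c
      reassociate : ∀ r k → iK (w r) * (iK (M r k) * v k) ≈ iK (M r k ℤ.* w r) * v k
      reassociate r k = begin
        iK (w r) * (iK (M r k) * v k)   ≈⟨ sym (*-assoc _ _ _) ⟩
        (iK (w r) * iK (M r k)) * v k   ≈⟨ *-congʳ (*-comm _ _) ⟩
        (iK (M r k) * iK (w r)) * v k   ≈⟨ *-congʳ (sym (intK-* (M r k) (w r))) ⟩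
        iK (M r k ℤ.* w r) * v k        ∎
      combination≈ : sum n (λ r → iK (w r) * sum n (λ k → iK (M r k) * v k)) ≈ iK (determinant n M) * v c
      combination≈ = begin
        sum n (λ r → iK (w r) * sum n (λ k → iK (M r k) * v k))
          ≈⟨ sum-cong n (λ r _ → sum-*ˡ n (iK (w r)) _) ⟩
        sum n (λ r → sum n (λ k → iK (w r) * (iK (M r k) * v k)))
          ≈⟨ sum-swap n n _ ⟩
        sum n (λ k → sum n (λ r → iK (w r) * (iK (M r k) * v k)))
          ≈⟨ sum-cong n (λ k _ → sum-cong n (λ r _ → reassociate r k)) ⟩
        sum n (λ k → sum n (λ r → iK (M r k ℤ.* w r) * v k))
          ≈⟨ sum-cong n (λ k _ → sym (sum-*ʳ n (v k) _)) ⟩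
        sum n (λ k → sum n (λ r → iK (M r k ℤ.* w r)) * v k)
          ≈⟨ sum-cong n (λ k _ → *-congʳ (sym (intK-sum n _))) ⟩
        sum n (λ k → iK (IntegerDeterminant.sum n (λ r → M r k ℤ.* w r)) * v k)
          ≈⟨ sum-cong n (λ k k<n → *-congʳ (reflexive (≡.cong iK (cofactor-expansion n c k M c<n k<n)))) ⟩
        sum n (λ k → iK (ifEq k c (determinant n M) (+ 0)) * v k)
          ≈⟨ sum-single n c _ c<n (λ k _ k≢c → trans (*-congʳ (reflexive (≡.cong iK (ifEq-≢ k c _ _ k≢c)))) (zeroˡ (v k))) ⟩
        iK (ifEq c c (determinant n M) (+ 0)) * v c
          ≈⟨ *-congʳ (reflexive (≡.cong iK (ifEq-≡ c _ _))) ⟩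
        iK (determinant n M) * v c ∎

module Powers {c ℓ} (K : CommutativeRing c ℓ) where
  open CommutativeRing K
  open import Algebra.Properties.CommutativeSemigroup *-commutativeSemigroup using (interchange)

  infixr 8 _^_
  _^_ : Carrier → ℕ → Carrier
  x ^ k = pow K x k

  ^-+ : ∀ x i j → x ^ (i ℕ.+ j) ≈ x ^ i * x ^ j
  ^-+ x zero    j = sym (*-identityˡ _)
  ^-+ x (suc i) j = trans (*-congˡ (^-+ x i j)) (sym (*-assoc x _ _))

  ^-distrib-* : ∀ x y k → (x * y) ^ k ≈ x ^ k * y ^ k
  ^-distrib-* x y zero    = sym (*-identityˡ 1#)
  ^-distrib-* x y (suc k) = trans (*-congˡ (^-distrib-* x y k)) (interchange x y _ _)

  square-^ : ∀ x k → (x * x) ^ k ≈ x ^ (k ℕ.+ k)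
  square-^ x k = trans (^-distrib-* x x k) (sym (^-+ x k k))

module SylvesterRows {c ℓ} (K : CommutativeRing c ℓ) (a b : CommutativeRing.Carrier K) where
  open import Data.List using (List; []; _∷_)
  open import Data.Vec using ([]; _∷_; toList)
  open import Data.Bool using (true; false; if_then_else_)
  open CommutativeRing K
  open import Relation.Binary.Reasoning.Setoid setoid
  open IntegerEmbedding K using (iK; module Solver)
  open Solver using (solve; _:=_; _:+_; _:*_)
  open IntegerDeterminant using (Matrix; determinant; det≡determinant)
  open Sums K
  open Cramer K
  open Powers K

  monomial : ℕ → ℕ → Carrier
  monomial N k = a ^ (N ∸ k) * b ^ k

  shiftedCoef : ℕ → List ℤ → ℕ → ℤ
  shiftedCoef zero    cs k       = coefAt cs k
  shiftedCoef (suc r) cs zero    = + 0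
  shiftedCoef (suc r) cs (suc k) = shiftedCoef r cs k

  shiftedCoef-if : ∀ r cs k → (if r ℕ.≤ᵇ k then coefAt cs (k ∸ r) else + 0) ≡ shiftedCoef r cs k
  shiftedCoef-if zero          cs k       = ≡.refl
  shiftedCoef-if (suc r)       cs zero    = ≡.refl
  shiftedCoef-if (suc zero)    cs (suc k) = ≡.refl
  shiftedCoef-if (suc (suc r)) cs (suc k) = shiftedCoef-if (suc r) cs k

  sylvesterℕ : ∀ m n → HomPoly m → HomPoly n → Matrix
  sylvesterℕ m n A B r k =
    if r ℕ.<ᵇ n
    then (if r ℕ.≤ᵇ k then coefAt (toList A) (k ∸ r) else + 0)
    else (if (r ∸ n) ℕ.≤ᵇ k then coefAt (toList B) (k ∸ (r ∸ n)) else + 0)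

  <⇒<ᵇ≡true : ∀ {r n} → r < n → (r ℕ.<ᵇ n) ≡ true
  <⇒<ᵇ≡true {zero}  {suc n} _         = ≡.refl
  <⇒<ᵇ≡true {suc r} {suc n} (s≤s r<n) = <⇒<ᵇ≡true r<n

  ≥⇒<ᵇ≡false : ∀ {r n} → n ≤ r → (r ℕ.<ᵇ n) ≡ false
  ≥⇒<ᵇ≡false {r}     {zero}  _         = ≡.refl
  ≥⇒<ᵇ≡false {suc r} {suc n} (s≤s n≤r) = ≥⇒<ᵇ≡false n≤r

  Res≡determinant : ∀ m n A B → Res m n A B ≡ determinant (m ℕ.+ n) (sylvesterℕ m n A B)
  Res≡determinant m n A B = det≡determinant (m ℕ.+ n) (sylvester m n A B) (sylvesterℕ m n A B) (λ _ _ → ≡.refl)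

  sylvesterℕ-A-row : ∀ m n A B r → r < n → ∀ k → sylvesterℕ m n A B r k ≡ shiftedCoef r (toList A) k
  sylvesterℕ-A-row m n A B r r<n k rewrite <⇒<ᵇ≡true r<n = shiftedCoef-if r (toList A) k

  sylvesterℕ-B-row : ∀ m n A B r → n ≤ r → ∀ k → sylvesterℕ m n A B r k ≡ shiftedCoef (r ∸ n) (toList B) k
  sylvesterℕ-B-row m n A B r n≤r k rewrite ≥⇒<ᵇ≡false n≤r = shiftedCoef-if (r ∸ n) (toList B) k

  evalRow : ℕ → (ℕ → ℤ) → Carrier
  evalRow N row = sum (suc N) (λ k → iK (row k) * monomial N k)

  evalRow-cong : ∀ N {f g} → (∀ k → f k ≡ g k) → evalRow N f ≈ evalRow N g
  evalRow-cong N {f} {g} f≡g =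
    sum-cong (suc N) {g = λ k → iK (g k) * monomial N k} (λ k _ → *-congʳ (reflexive (≡.cong iK (f≡g k))))

  sum-monomial-suc : ∀ n N (g : ℕ → Carrier) →
    sum n (λ k → g k * monomial (suc N) (suc k)) ≈ b * sum n (λ k → g k * monomial N k)
  sum-monomial-suc n N g = trans (sum-cong n (λ k _ → move-b (g k) (a ^ (N ∸ k)) (b ^ k))) (sym (sum-*ˡ n b _))
    where
    move-b : ∀ x y z → x * (y * (b * z)) ≈ b * (x * (y * z))
    move-b = solve 4 (λ b x y z → x :* (y :* (b :* z)) := b :* (x :* (y :* z))) refl b

  evalRow-coefficients : ∀ l (A : HomPoly l) N → l ≤ N →
    evalRow N (coefAt (toList A)) ≈ a ^ (N ∸ l) * evalHom K l A a b
  evalRow-coefficients zero (x ∷ []) N _ = begin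
    iK x * (a ^ N * 1#) + sum N (λ k → iK (+ 0) * monomial N (suc k))
      ≈⟨ +-cong (*-congˡ (*-identityʳ _)) (sum-zero N (λ k _ → zeroˡ _)) ⟩
    iK x * a ^ N + 0#   ≈⟨ +-identityʳ _ ⟩
    iK x * a ^ N        ≈⟨ *-comm _ _ ⟩
    a ^ N * iK x        ∎
  evalRow-coefficients (suc l) (x ∷ A) (suc N) (s≤s l≤N) = begin
    iK x * (a ^ suc N * 1#) + sum (suc N) (λ k → iK (coefAt (toList A) k) * monomial (suc N) (suc k))
      ≈⟨ +-cong (*-congˡ (trans (*-identityʳ _) aˢᴺ≈)) (sum-monomial-suc (suc N) N (λ k → iK (coefAt (toList A) k))) ⟩
    iK x * (a ^ (N ∸ l) * a ^ suc l) + b * evalRow N (coefAt (toList A))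
      ≈⟨ +-congˡ (*-congˡ (evalRow-coefficients l A N l≤N)) ⟩
    iK x * (a ^ (N ∸ l) * a ^ suc l) + b * (a ^ (N ∸ l) * evalHom K l A a b)
      ≈⟨ factor (iK x) (a ^ (N ∸ l)) (a ^ suc l) (evalHom K l A a b) ⟩
    a ^ (N ∸ l) * (iK x * a ^ suc l + b * evalHom K l A a b) ∎
    where
    aˢᴺ≈ : a ^ suc N ≈ a ^ (N ∸ l) * a ^ suc l
    aˢᴺ≈ = trans (reflexive (≡.cong (a ^_) (≡.sym (≡.trans (ℕP.+-suc (N ∸ l) l) (≡.cong suc (ℕP.m∸n+n≡m l≤N))))))
                 (^-+ a (N ∸ l) (suc l))
    factor : ∀ x p q e → x * (p * q) + b * (p * e) ≈ p * (x * q + b * e)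
    factor = solve 5 (λ b x p q e → x :* (p :* q) :+ b :* (p :* e) := p :* (x :* q :+ b :* e)) refl b

  evalRow-shifted : ∀ r l (A : HomPoly l) N → r ℕ.+ l ≤ N →
    evalRow N (shiftedCoef r (toList A)) ≈ b ^ r * (a ^ (N ∸ (r ℕ.+ l)) * evalHom K l A a b)
  evalRow-shifted zero l A N l≤N = trans (evalRow-coefficients l A N l≤N) (sym (*-identityˡ _))
  evalRow-shifted (suc r) l A (suc N) (s≤s r+l≤N) = begin
    iK (+ 0) * monomial (suc N) 0 + sum (suc N) (λ k → iK (shiftedCoef r (toList A) k) * monomial (suc N) (suc k))
      ≈⟨ +-cong (zeroˡ _) (sum-monomial-suc (suc N) N (λ k → iK (shiftedCoef r (toList A) k))) ⟩
    0# + b * evalRow N (shiftedCoef r (toList A))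
      ≈⟨ +-identityˡ _ ⟩
    b * evalRow N (shiftedCoef r (toList A))
      ≈⟨ *-congˡ (evalRow-shifted r l A N r+l≤N) ⟩
    b * (b ^ r * (a ^ (N ∸ (r ℕ.+ l)) * evalHom K l A a b))
      ≈⟨ sym (*-assoc _ _ _) ⟩
    b ^ suc r * (a ^ (N ∸ (r ℕ.+ l)) * evalHom K l A a b) ∎

  evalRow-sylvester-A : ∀ m′ n A B r → r < n →
    evalRow (m′ ℕ.+ n) (sylvesterℕ (suc m′) n A B r) ≈
    b ^ r * (a ^ (m′ ℕ.+ n ∸ (r ℕ.+ suc m′)) * evalHom K (suc m′) A a b)
  evalRow-sylvester-A m′ n A B r r<n =
    trans (evalRow-cong (m′ ℕ.+ n) (sylvesterℕ-A-row (suc m′) n A B r r<n))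
          (evalRow-shifted r (suc m′) A (m′ ℕ.+ n) r+m≤N)
    where
    r+m≤N : r ℕ.+ suc m′ ≤ m′ ℕ.+ n
    r+m≤N = ℕP.≤-trans (ℕP.≤-reflexive (ℕP.+-suc r m′))
              (ℕP.≤-trans (ℕP.+-monoˡ-≤ m′ r<n) (ℕP.≤-reflexive (ℕP.+-comm n m′)))

  evalRow-sylvester-B : ∀ m′ n A B r → n ≤ r → r < suc m′ ℕ.+ n →
    evalRow (m′ ℕ.+ n) (sylvesterℕ (suc m′) n A B r) ≈
    b ^ (r ∸ n) * (a ^ (m′ ℕ.+ n ∸ ((r ∸ n) ℕ.+ n)) * evalHom K n B a b)
  evalRow-sylvester-B m′ n A B r n≤r r<m+n =
    trans (evalRow-cong (m′ ℕ.+ n) (sylvesterℕ-B-row (suc m′) n A B r n≤r))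
          (evalRow-shifted (r ∸ n) n B (m′ ℕ.+ n) r-n+n≤N)
    where
    r-n+n≤N : (r ∸ n) ℕ.+ n ≤ m′ ℕ.+ n
    r-n+n≤N = ℕP.+-monoˡ-≤ n (ℕP.≤-trans (ℕP.∸-monoˡ-≤ n (ℕP.≤-pred r<m+n)) (ℕP.≤-reflexive (ℕP.m+n∸n≡m m′ n)))

  module _ {ℓi} {I : Pred Carrier ℓi} (isI : IsℤSubmodule I) where
    open IsℤSubmodule isI

    resultant-∈ : ∀ m′ n (A : HomPoly (suc m′)) (B : HomPoly n) →
      (∀ i j → I (b ^ j * (a ^ i * evalHom K (suc m′) A a b))) →
      (∀ i j → I (b ^ j * (a ^ i * evalHom K n B a b))) →
      ∀ k → k < suc m′ ℕ.+ n → I (iK (Res (suc m′) n A B) * monomial (m′ ℕ.+ n) k)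
    resultant-∈ m′ n A B A-multiples∈ B-multiples∈ k k<m+n =
      ∈-resp-≈ (*-congʳ (reflexive (≡.cong iK (≡.sym (Res≡determinant (suc m′) n A B)))))
        (cramer isI (suc m′ ℕ.+ n) (sylvesterℕ (suc m′) n A B) k k<m+n (monomial (m′ ℕ.+ n)) row∈)
      where
      row∈ : ∀ r → r < suc m′ ℕ.+ n → I (evalRow (m′ ℕ.+ n) (sylvesterℕ (suc m′) n A B r))
      row∈ r r<m+n with r ℕ.<? n
      ... | yes r<n = ∈-resp-≈ (sym (evalRow-sylvester-A m′ n A B r r<n))
                                (A-multiples∈ (m′ ℕ.+ n ∸ (r ℕ.+ suc m′)) r)
      ... | no r≮n  = ∈-resp-≈ (sym (evalRow-sylvester-B m′ n A B r (ℕP.≮⇒≥ r≮n) r<m+n))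
                                (B-multiples∈ (m′ ℕ.+ n ∸ ((r ∸ n) ℕ.+ n)) (r ∸ n))

module Subring {c ℓ ℓ′} (K : CommutativeRing c ℓ) {D : Pred (CommutativeRing.Carrier K) ℓ′}
  (D-subring : IsSubring K D) where
  open import Level using (_⊔_)
  open CommutativeRing K
  open IsSubring D-subring public
  open IntegerEmbedding K using (iK; module Solver)
  open Solver using (solve; _:=_; _:+_; _:*_; _:-_)

  _∣_ : Carrier → Carrier → Set (c ⊔ ℓ ⊔ ℓ′)
  _∣_ = _∣D_ K D

  natK-∈ : ∀ n → D (natK K n)
  natK-∈ zero    = has0
  natK-∈ (suc n) = +-cl has1 (natK-∈ n)

  intK-∈ : ∀ z → D (iK z)
  intK-∈ (+ n)    = natK-∈ n
  intK-∈ -[1+ n ] = neg-cl (natK-∈ (suc n))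

  pow-∈ : ∀ {x} k → D x → D (pow K x k)
  pow-∈ zero    x∈ = has1
  pow-∈ (suc k) x∈ = *-cl x∈ (pow-∈ k x∈)

  record QuadraticOver (s y : Carrier) : Set (c ⊔ ℓ ⊔ ℓ′) where
    field
      e₀ e₁ f₀ f₁ : Carrier
      e₀∈ : D e₀
      e₁∈ : D e₁
      f₀∈ : D f₀
      f₁∈ : D f₁
      root : y * y + (f₀ + f₁ * s) ≈ (e₀ + e₁ * s) * y

  module _ {p} (p-prime : PrimeD K D p) where
    private
      p∈ : D p
      p∈ = proj₁ p-prime
      p-nonunit : ¬ UnitD K D p
      p-nonunit = proj₁ (proj₂ (proj₂ p-prime))
      p∣-product : ∀ x y → D x → D y → p ∣ (x * y) → p ∣ x ⊎ p ∣ y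
      p∣-product = proj₂ (proj₂ (proj₂ p-prime))

    prime-∣-square : ∀ {x} → D x → p ∣ (x * x) → p ∣ x
    prime-∣-square x∈ p∣x² with p∣-product _ _ x∈ x∈ p∣x²
    ... | inj₁ p∣x = p∣x
    ... | inj₂ p∣x = p∣x

    prime-∣-pow : ∀ {x} k → D x → p ∣ pow K x k → p ∣ x
    prime-∣-pow zero    x∈ (q , q∈ , 1≈pq) = ⊥-elim (p-nonunit (p∈ , q , q∈ , sym 1≈pq))
    prime-∣-pow (suc k) x∈ p∣xᵏ⁺¹ with p∣-product _ _ x∈ (pow-∈ k x∈) p∣xᵏ⁺¹
    ... | inj₁ p∣x  = p∣x
    ... | inj₂ p∣xᵏ = prime-∣-pow k x∈ p∣xᵏ

    -- Scaling the quadratic by p² gives u = s p g with u, g ∈ D; squaring removes s.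
    quadratic-multiple⇒∣ : ∀ {s y z} → D (s * s) → QuadraticOver s y → D z → z ≈ p * y → p ∣ z
    quadratic-multiple⇒∣ {s} {y} {z} s²∈ quadratic z∈ z≈py = prime-∣-square z∈ (p∣z² p∣u)
      where
      open QuadraticOver quadratic
      open import Relation.Binary.Reasoning.Setoid setoid
      u g : Carrier
      u = z * z - e₀ * p * z + f₀ * p * p
      g = e₁ * z - f₁ * p
      g∈ : D g
      g∈ = +-cl (*-cl e₁∈ z∈) (neg-cl (*-cl f₁∈ p∈))
      u∈ : D u
      u∈ = +-cl (+-cl (*-cl z∈ z∈) (neg-cl (*-cl (*-cl e₀∈ p∈) z∈))) (*-cl (*-cl f₀∈ p∈) p∈)
      u≈spg : u ≈ s * (p * g)
      u≈spg = begin
        u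
          ≈⟨ +-cong (+-cong (*-cong z≈py z≈py) (-‿cong (*-congˡ z≈py))) refl ⟩
        (p * y) * (p * y) - e₀ * p * (p * y) + f₀ * p * p
          ≈⟨ solve 7 (λ p y s e₀ e₁ f₀ f₁ →
               (p :* y) :* (p :* y) :- e₀ :* p :* (p :* y) :+ f₀ :* p :* p
                 := s :* (p :* (e₁ :* (p :* y) :- f₁ :* p))
                    :+ p :* p :* ((y :* y :+ (f₀ :+ f₁ :* s)) :- (e₀ :+ e₁ :* s) :* y))
               refl p y s e₀ e₁ f₀ f₁ ⟩
        s * (p * (e₁ * (p * y) - f₁ * p)) + p * p * ((y * y + (f₀ + f₁ * s)) - (e₀ + e₁ * s) * y)
          ≈⟨ +-cong (*-congˡ (*-congˡ (+-congʳ (*-congˡ (sym z≈py)))))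
                    (trans (*-congˡ (trans (+-congʳ root) (-‿inverseʳ _))) (zeroʳ _)) ⟩
        s * (p * g) + 0#
          ≈⟨ +-identityʳ _ ⟩
        s * (p * g) ∎
      p∣u : p ∣ u
      p∣u = prime-∣-square u∈ (s * s * (p * (g * g)) , *-cl s²∈ (*-cl p∈ (*-cl g∈ g∈)) ,
        trans (*-cong u≈spg u≈spg)
          (solve 3 (λ s p g → s :* (p :* g) :* (s :* (p :* g)) := p :* (s :* s :* (p :* (g :* g)))) refl s p g))
      p∣z² : p ∣ u → p ∣ (z * z)
      p∣z² (q , q∈ , u≈pq) =
        q + (e₀ * z - f₀ * p) , +-cl q∈ (+-cl (*-cl e₀∈ z∈) (neg-cl (*-cl f₀∈ p∈))) , (begin
        z * z
          ≈⟨ solve 4 (λ z p e₀ f₀ →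
               z :* z := (z :* z :- e₀ :* p :* z :+ f₀ :* p :* p) :+ p :* (e₀ :* z :- f₀ :* p)) refl z p e₀ f₀ ⟩
        u + p * (e₀ * z - f₀ * p)      ≈⟨ +-congʳ u≈pq ⟩
        p * q + p * (e₀ * z - f₀ * p)  ≈⟨ sym (distribˡ p q _) ⟩
        p * (q + (e₀ * z - f₀ * p))    ∎)

module AdjoinedRoots {c ℓ ℓ′} (K : CommutativeRing c ℓ) {D : Pred (CommutativeRing.Carrier K) ℓ′}
  (D-subring : IsSubring K D) (a b : CommutativeRing.Carrier K)
  (s²∈ : D (CommutativeRing._*_ K (CommutativeRing._+_ K a b) (CommutativeRing._+_ K a b)))
  (ab∈ : D (CommutativeRing._*_ K a b)) where
  open import Level using (_⊔_)
  open CommutativeRing K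
  open Subring K D-subring
  open IntegerEmbedding K using (iK; module Solver)
  open Solver using (solve; _:=_; _:+_; _:*_; _:-_; :-_; con)
  open Powers K
  open Cramer K using (IsℤSubmodule)
  open SylvesterRows K a b using (monomial; resultant-∈)
  open import Relation.Binary.Reasoning.Setoid setoid

  s : Carrier
  s = a + b

  -- Since s² ∈ D and a² = s a − a b, the D-span of 1, s, a, s a is already a ring.
  record D[a,b] (y : Carrier) : Set (c ⊔ ℓ ⊔ ℓ′) where
    constructor span
    field
      d₀ d₁ d₂ d₃ : Carrier
      d₀∈ : D d₀
      d₁∈ : D d₁
      d₂∈ : D d₂
      d₃∈ : D d₃
      y≈ : y ≈ d₀ + d₁ * s + d₂ * a + d₃ * (s * a)

  D[a,b]-resp-≈ : ∀ {x y} → x ≈ y → D[a,b] x → D[a,b] y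
  D[a,b]-resp-≈ x≈y (span d₀ d₁ d₂ d₃ d₀∈ d₁∈ d₂∈ d₃∈ x≈) = span d₀ d₁ d₂ d₃ d₀∈ d₁∈ d₂∈ d₃∈ (trans (sym x≈y) x≈)

  D⊆D[a,b] : ∀ {x} → D x → D[a,b] x
  D⊆D[a,b] {x} x∈ = span x 0# 0# 0# x∈ has0 has0 has0
    (solve 3 (λ x a b → x := x :+ con (+ 0) :* (a :+ b) :+ con (+ 0) :* a :+ con (+ 0) :* ((a :+ b) :* a)) refl x a b)

  D[a,b]-+ : ∀ {x y} → D[a,b] x → D[a,b] y → D[a,b] (x + y)
  D[a,b]-+ (span x₀ x₁ x₂ x₃ x₀∈ x₁∈ x₂∈ x₃∈ x≈) (span y₀ y₁ y₂ y₃ y₀∈ y₁∈ y₂∈ y₃∈ y≈) =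
    span _ _ _ _ (+-cl x₀∈ y₀∈) (+-cl x₁∈ y₁∈) (+-cl x₂∈ y₂∈) (+-cl x₃∈ y₃∈)
      (trans (+-cong x≈ y≈) (solve 10 (λ x₀ x₁ x₂ x₃ y₀ y₁ y₂ y₃ a b →
        x₀ :+ x₁ :* (a :+ b) :+ x₂ :* a :+ x₃ :* ((a :+ b) :* a) :+ (y₀ :+ y₁ :* (a :+ b) :+ y₂ :* a :+ y₃ :* ((a :+ b) :* a))
          := x₀ :+ y₀ :+ (x₁ :+ y₁) :* (a :+ b) :+ (x₂ :+ y₂) :* a :+ (x₃ :+ y₃) :* ((a :+ b) :* a))
        refl x₀ x₁ x₂ x₃ y₀ y₁ y₂ y₃ a b))

  D[a,b]-neg : ∀ {x} → D[a,b] x → D[a,b] (- x)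
  D[a,b]-neg (span x₀ x₁ x₂ x₃ x₀∈ x₁∈ x₂∈ x₃∈ x≈) =
    span _ _ _ _ (neg-cl x₀∈) (neg-cl x₁∈) (neg-cl x₂∈) (neg-cl x₃∈)
      (trans (-‿cong x≈) (solve 6 (λ x₀ x₁ x₂ x₃ a b →
        :- (x₀ :+ x₁ :* (a :+ b) :+ x₂ :* a :+ x₃ :* ((a :+ b) :* a))
          := :- x₀ :+ :- x₁ :* (a :+ b) :+ :- x₂ :* a :+ :- x₃ :* ((a :+ b) :* a)) refl x₀ x₁ x₂ x₃ a b))

  D[a,b]-D* : ∀ {x y} → D x → D[a,b] y → D[a,b] (x * y)
  D[a,b]-D* {x} x∈ (span y₀ y₁ y₂ y₃ y₀∈ y₁∈ y₂∈ y₃∈ y≈) =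
    span _ _ _ _ (*-cl x∈ y₀∈) (*-cl x∈ y₁∈) (*-cl x∈ y₂∈) (*-cl x∈ y₃∈)
      (trans (*-congˡ y≈) (solve 7 (λ x y₀ y₁ y₂ y₃ a b →
        x :* (y₀ :+ y₁ :* (a :+ b) :+ y₂ :* a :+ y₃ :* ((a :+ b) :* a))
          := x :* y₀ :+ x :* y₁ :* (a :+ b) :+ x :* y₂ :* a :+ x :* y₃ :* ((a :+ b) :* a)) refl x y₀ y₁ y₂ y₃ a b))

  D[a,b]-s* : ∀ {y} → D[a,b] y → D[a,b] (s * y)
  D[a,b]-s* (span d₀ d₁ d₂ d₃ d₀∈ d₁∈ d₂∈ d₃∈ y≈) =
    span _ _ _ _ (*-cl d₁∈ s²∈) d₀∈ (*-cl d₃∈ s²∈) d₂∈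
      (trans (*-congˡ y≈) (solve 6 (λ d₀ d₁ d₂ d₃ a b →
        (a :+ b) :* (d₀ :+ d₁ :* (a :+ b) :+ d₂ :* a :+ d₃ :* ((a :+ b) :* a))
          := d₁ :* ((a :+ b) :* (a :+ b)) :+ d₀ :* (a :+ b) :+ d₃ :* ((a :+ b) :* (a :+ b)) :* a :+ d₂ :* ((a :+ b) :* a))
        refl d₀ d₁ d₂ d₃ a b))

  D[a,b]-a* : ∀ {y} → D[a,b] y → D[a,b] (a * y)
  D[a,b]-a* (span d₀ d₁ d₂ d₃ d₀∈ d₁∈ d₂∈ d₃∈ y≈) =
    span _ _ _ _ (neg-cl (*-cl d₂∈ ab∈)) (neg-cl (*-cl d₃∈ ab∈)) (+-cl d₀∈ (*-cl d₃∈ s²∈)) (+-cl d₁∈ d₂∈)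
      (trans (*-congˡ y≈) (solve 6 (λ d₀ d₁ d₂ d₃ a b →
        a :* (d₀ :+ d₁ :* (a :+ b) :+ d₂ :* a :+ d₃ :* ((a :+ b) :* a))
          := :- (d₂ :* (a :* b)) :+ :- (d₃ :* (a :* b)) :* (a :+ b) :+ (d₀ :+ d₃ :* ((a :+ b) :* (a :+ b))) :* a
             :+ (d₁ :+ d₂) :* ((a :+ b) :* a))
        refl d₀ d₁ d₂ d₃ a b))

  D[a,b]-b* : ∀ {y} → D[a,b] y → D[a,b] (b * y)
  D[a,b]-b* {y} y∈ = D[a,b]-resp-≈ (solve 3 (λ y a b → (a :+ b) :* y :- a :* y := b :* y) refl y a b)
    (D[a,b]-+ (D[a,b]-s* y∈) (D[a,b]-neg (D[a,b]-a* y∈)))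

  D[a,b]-* : ∀ {x y} → D[a,b] x → D[a,b] y → D[a,b] (x * y)
  D[a,b]-* {x} x∈ (span y₀ y₁ y₂ y₃ y₀∈ y₁∈ y₂∈ y₃∈ y≈) =
    D[a,b]-resp-≈ (sym (trans (*-congˡ y≈) (solve 7 (λ x y₀ y₁ y₂ y₃ a b →
        x :* (y₀ :+ y₁ :* (a :+ b) :+ y₂ :* a :+ y₃ :* ((a :+ b) :* a))
          := y₀ :* x :+ y₁ :* ((a :+ b) :* x) :+ y₂ :* (a :* x) :+ y₃ :* ((a :+ b) :* (a :* x)))
        refl x y₀ y₁ y₂ y₃ a b)))
      (D[a,b]-+ (D[a,b]-+ (D[a,b]-+ (D[a,b]-D* y₀∈ x∈) (D[a,b]-D* y₁∈ (D[a,b]-s* x∈)))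
                          (D[a,b]-D* y₂∈ (D[a,b]-a* x∈)))
                (D[a,b]-D* y₃∈ (D[a,b]-s* (D[a,b]-a* x∈))))

  a∈D[a,b] : D[a,b] a
  a∈D[a,b] = D[a,b]-resp-≈ (*-identityʳ a) (D[a,b]-a* (D⊆D[a,b] has1))

  b∈D[a,b] : D[a,b] b
  b∈D[a,b] = D[a,b]-resp-≈ (*-identityʳ b) (D[a,b]-b* (D⊆D[a,b] has1))

  s∈D[a,b] : D[a,b] s
  s∈D[a,b] = D[a,b]-+ a∈D[a,b] b∈D[a,b]

  D[a,b]-pow : ∀ {x} k → D[a,b] x → D[a,b] (pow K x k)
  D[a,b]-pow zero    x∈ = D⊆D[a,b] has1
  D[a,b]-pow (suc k) x∈ = D[a,b]-* x∈ (D[a,b]-pow k x∈)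

  -- e₀ + e₁ s and f₀ + f₁ s are the sum and the product of y and its image under a ↔ b.
  D[a,b]-quadratic : ∀ {y} → D[a,b] y → QuadraticOver s y
  D[a,b]-quadratic {y} (span d₀ d₁ d₂ d₃ d₀∈ d₁∈ d₂∈ d₃∈ y≈) = record
    { e₀ = e₀ ; e₁ = e₁ ; f₀ = f₀ ; f₁ = f₁
    ; e₀∈ = +-cl (+-cl d₀∈ d₀∈) (*-cl d₃∈ s²∈)
    ; e₁∈ = +-cl (+-cl d₁∈ d₁∈) d₂∈
    ; f₀∈ = +-cl (+-cl (+-cl (+-cl (+-cl (*-cl d₀∈ d₀∈) (*-cl (*-cl d₁∈ d₁∈) s²∈)) (*-cl (*-cl d₀∈ d₃∈) s²∈))
                   (*-cl (*-cl d₁∈ d₂∈) s²∈)) (*-cl (*-cl d₂∈ d₂∈) ab∈)) (*-cl (*-cl (*-cl d₃∈ d₃∈) s²∈) ab∈)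
    ; f₁∈ = +-cl (+-cl (+-cl (+-cl (+-cl (*-cl d₀∈ d₁∈) (*-cl d₀∈ d₁∈)) (*-cl d₀∈ d₂∈)) (*-cl (*-cl d₁∈ d₃∈) s²∈))
                   (*-cl (*-cl d₂∈ d₃∈) ab∈)) (*-cl (*-cl d₂∈ d₃∈) ab∈)
    ; root = trans (+-congʳ (*-cong y≈ y≈)) (trans trace-norm (*-congˡ (sym y≈)))
    }
    where
    e₀ e₁ f₀ f₁ Y : Carrier
    e₀ = d₀ + d₀ + d₃ * (s * s)
    e₁ = d₁ + d₁ + d₂
    f₀ = d₀ * d₀ + d₁ * d₁ * (s * s) + d₀ * d₃ * (s * s) + d₁ * d₂ * (s * s) + d₂ * d₂ * (a * b)
         + d₃ * d₃ * (s * s) * (a * b)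
    f₁ = d₀ * d₁ + d₀ * d₁ + d₀ * d₂ + d₁ * d₃ * (s * s) + d₂ * d₃ * (a * b) + d₂ * d₃ * (a * b)
    Y = d₀ + d₁ * s + d₂ * a + d₃ * (s * a)
    trace-norm : Y * Y + (f₀ + f₁ * s) ≈ (e₀ + e₁ * s) * Y
    trace-norm = solve 6 (λ d₀ d₁ d₂ d₃ a b →
      let s = a :+ b
          y = d₀ :+ d₁ :* s :+ d₂ :* a :+ d₃ :* (s :* a)
      in y :* y :+ ((d₀ :* d₀ :+ d₁ :* d₁ :* (s :* s) :+ d₀ :* d₃ :* (s :* s) :+ d₁ :* d₂ :* (s :* s)
                     :+ d₂ :* d₂ :* (a :* b) :+ d₃ :* d₃ :* (s :* s) :* (a :* b))
                    :+ (d₀ :* d₁ :+ d₀ :* d₁ :+ d₀ :* d₂ :+ d₁ :* d₃ :* (s :* s) :+ d₂ :* d₃ :* (a :* b)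
                        :+ d₂ :* d₃ :* (a :* b)) :* s)
         := ((d₀ :+ d₀ :+ d₃ :* (s :* s)) :+ (d₁ :+ d₁ :+ d₂) :* s) :* y) refl d₀ d₁ d₂ d₃ a b

  record SplitPower (i j : ℕ) : Set (c ⊔ ℓ ⊔ ℓ′) where
    constructor split
    field
      u v : Carrier
      u∈ : D[a,b] u
      v∈ : D[a,b] v
      s^i+j≈ : s ^ (i ℕ.+ j) ≈ a ^ i * u + b ^ j * v

  split-power : ∀ i j → SplitPower i j
  split-power zero j = split (s ^ j) 0# (D[a,b]-pow j s∈D[a,b]) (D⊆D[a,b] has0)
    (sym (trans (+-cong (*-identityˡ _) (zeroʳ _)) (+-identityʳ _)))
  split-power (suc i) zero = split 0# (s ^ (suc i ℕ.+ 0)) (D⊆D[a,b] has0) (D[a,b]-pow (suc i ℕ.+ 0) s∈D[a,b])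
    (sym (trans (+-cong (zeroʳ _) (*-identityˡ _)) (+-identityˡ _)))
  split-power (suc i) (suc j) with split-power i (suc j) | split-power (suc i) j
  ... | split u₁ v₁ u₁∈ v₁∈ eq₁ | split u₂ v₂ u₂∈ v₂∈ eq₂ =
    split (u₁ + b * u₂) (a * v₁ + v₂) (D[a,b]-+ u₁∈ (D[a,b]-b* u₂∈)) (D[a,b]-+ (D[a,b]-a* v₁∈) v₂∈)
    (begin
      s * s ^ (i ℕ.+ suc j)
        ≈⟨ distribʳ _ a b ⟩
      a * s ^ (i ℕ.+ suc j) + b * s ^ (i ℕ.+ suc j)
        ≈⟨ +-cong (*-congˡ eq₁) (*-congˡ (trans (reflexive (≡.cong (s ^_) (ℕP.+-suc i j))) eq₂)) ⟩
      a * (a ^ i * u₁ + b ^ suc j * v₁) + b * (a ^ suc i * u₂ + b ^ j * v₂)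
        ≈⟨ solve 8 (λ a b aⁱ bʲ u₁ v₁ u₂ v₂ →
             a :* (aⁱ :* u₁ :+ (b :* bʲ) :* v₁) :+ b :* ((a :* aⁱ) :* u₂ :+ bʲ :* v₂)
               := (a :* aⁱ) :* (u₁ :+ b :* u₂) :+ (b :* bʲ) :* (a :* v₁ :+ v₂)) refl a b (a ^ i) (b ^ j) u₁ v₁ u₂ v₂ ⟩
      a ^ suc i * (u₁ + b * u₂) + b ^ suc j * (a * v₁ + v₂) ∎)

  module _ {p} (p-prime : PrimeD K D p) where

    pD[a,b] : Pred Carrier (c ⊔ ℓ ⊔ ℓ′)
    pD[a,b] x = Σ[ y ∈ Carrier ] (D[a,b] y × x ≈ p * y)

    pD[a,b]-*ˡ : ∀ {r x} → D[a,b] r → pD[a,b] x → pD[a,b] (r * x)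
    pD[a,b]-*ˡ {r} r∈ (y , y∈ , x≈py) =
      r * y , D[a,b]-* r∈ y∈ ,
      trans (*-congˡ x≈py) (trans (sym (*-assoc r p y)) (trans (*-congʳ (*-comm r p)) (*-assoc p r y)))

    pD[a,b]-isℤSubmodule : IsℤSubmodule pD[a,b]
    pD[a,b]-isℤSubmodule = record
      { ∈-resp-≈ = λ { x≈x′ (y , y∈ , x≈py) → y , y∈ , trans (sym x≈x′) x≈py }
      ; 0∈      = 0# , D⊆D[a,b] has0 , sym (zeroʳ p)
      ; +-∈     = λ { (y₁ , y₁∈ , x₁≈) (y₂ , y₂∈ , x₂≈) →
                    y₁ + y₂ , D[a,b]-+ y₁∈ y₂∈ , trans (+-cong x₁≈ x₂≈) (sym (distribˡ p y₁ y₂)) }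
      ; ℤ*-∈    = λ z → pD[a,b]-*ˡ (D⊆D[a,b] (intK-∈ z))
      }
    open IsℤSubmodule pD[a,b]-isℤSubmodule

    pD[a,b]-*ʳ : ∀ {x r} → pD[a,b] x → D[a,b] r → pD[a,b] (x * r)
    pD[a,b]-*ʳ x∈ r∈ = ∈-resp-≈ (*-comm _ _) (pD[a,b]-*ˡ r∈ x∈)

    D∩pD[a,b]⊆pD : ∀ {x} → D x → pD[a,b] x → p ∣ x
    D∩pD[a,b]⊆pD x∈ (y , y∈ , x≈py) = quadratic-multiple⇒∣ p-prime s²∈ (D[a,b]-quadratic y∈) x∈ x≈py

    pow-∈pD[a,b]⇒∣ : ∀ {x} k → D x → pD[a,b] (x ^ k) → p ∣ x
    pow-∈pD[a,b]⇒∣ k x∈ xᵏ∈ = prime-∣-pow p-prime k x∈ (D∩pD[a,b]⊆pD (pow-∈ k x∈) xᵏ∈)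

    ∣⇒pD[a,b] : ∀ {x} → p ∣ x → pD[a,b] x
    ∣⇒pD[a,b] (y , y∈ , x≈py) = y , D⊆D[a,b] y∈ , x≈py

    common-divisor-of-resultant-pair : ∀ m′ n (A : HomPoly (suc m′)) (B : HomPoly n) →
      Res (suc m′) n A B ≡ + 1 ⊎ Res (suc m′) n A B ≡ ℤ.- (+ 1) →
      p ∣ evalHom K (suc m′) A a b → p ∣ evalHom K n B a b → p ∣ (s * s) × p ∣ (a * b)
    common-divisor-of-resultant-pair m′ n A B Res-unit p∣A p∣B =
      pow-∈pD[a,b]⇒∣ N s²∈ (∈-resp-≈ (sym (square-^ s N)) sᴺ⁺ᴺ∈) ,
      pow-∈pD[a,b]⇒∣ N ab∈ (∈-resp-≈ (sym (^-distrib-* a b N)) (pD[a,b]-*ʳ aᴺ∈ (D[a,b]-pow N b∈D[a,b])))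
      where
      N : ℕ
      N = m′ ℕ.+ n
      multiples∈ : ∀ {x} → p ∣ x → ∀ i j → pD[a,b] (b ^ j * (a ^ i * x))
      multiples∈ p∣x i j =
        pD[a,b]-*ˡ (D[a,b]-pow j b∈D[a,b]) (pD[a,b]-*ˡ (D[a,b]-pow i a∈D[a,b]) (∣⇒pD[a,b] p∣x))
      monomial∈ : ∀ k → k < suc N → pD[a,b] (monomial N k)
      monomial∈ k k<N = ±1*-∈⁻¹ _ Res-unit
        (resultant-∈ pD[a,b]-isℤSubmodule m′ n A B (multiples∈ p∣A) (multiples∈ p∣B) k k<N)
      aᴺ∈ : pD[a,b] (a ^ N)
      aᴺ∈ = ∈-resp-≈ (*-identityʳ _) (monomial∈ 0 (s≤s z≤n))
      bᴺ∈ : pD[a,b] (b ^ N)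
      bᴺ∈ = ∈-resp-≈ (trans (*-congʳ (reflexive (≡.cong (a ^_) (ℕP.n∸n≡0 N)))) (*-identityˡ _))
                      (monomial∈ N (ℕP.n<1+n N))
      sᴺ⁺ᴺ∈ : pD[a,b] (s ^ (N ℕ.+ N))
      sᴺ⁺ᴺ∈ = ∈-resp-≈ (sym s^i+j≈) (+-∈ (pD[a,b]-*ʳ aᴺ∈ u∈) (pD[a,b]-*ʳ bᴺ∈ v∈))
        where open SplitPower (split-power N N)

open import Data.Integer using (-_)

lemma2p3 : ∀ {c ℓ ℓ'} (K : CommutativeRing c ℓ) → IsField K →
    (D : Pred (CommutativeRing.Carrier K) ℓ') → IsUFD K D →
    (a b : CommutativeRing.Carrier K) →
    AlgebraicOver K D a → AlgebraicOver K D b →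
    CoprimeD K D (pow K (CommutativeRing._+_ K a b) 2) (CommutativeRing._*_ K a b) →
    (m n : ℕ) (A : HomPoly m) (B : HomPoly n) →
    NonConstant A → NonConstant B →
    (Res m n A B ≡ + 1 ⊎ Res m n A B ≡ - (+ 1)) →
    D (evalHom K m A a b) → D (evalHom K n B a b) →
    CoprimeD K D (evalHom K m A a b) (evalHom K n B a b)
lemma2p3 _ _ _ _ _ _ _ _ _ zero _ _ _ (() , _) _ _ _ _
lemma2p3 K _ D D-ufd a b _ _ (s²∈′ , ab∈ , no-common-prime) (suc m′) n A B _ _ Res-unit A∈ B∈ =
  A∈ , B∈ , λ p p-prime (p∣A , p∣B) →
    no-common-prime p p-prime (common-divisor p-prime p∣A p∣B)
  where
  open CommutativeRing K
  D-subring : IsSubring K D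
  D-subring = IsUFD.subring D-ufd
  open Subring K D-subring using (_∣_)
  s²∈ : D ((a + b) * (a + b))
  s²∈ = resp (*-congˡ (*-identityʳ _)) s²∈′
    where open IsSubring D-subring
  open AdjoinedRoots K D-subring a b s²∈ ab∈ using (common-divisor-of-resultant-pair)
  common-divisor : ∀ {p} → PrimeD K D p → p ∣ evalHom K (suc m′) A a b → p ∣ evalHom K n B a b →
    p ∣ pow K (a + b) 2 × p ∣ (a * b)
  common-divisor p-prime p∣A p∣B =
    map₁ (λ { (q , q∈ , s²≈pq) → q , q∈ , trans (*-congˡ (*-identityʳ (a + b))) s²≈pq })
      (common-divisor-of-resultant-pair p-prime m′ n A B Res-unit p∣A p∣B)
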